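{- Let $P$ be a finite bounded poset (minimum $\hat0$, maximum $\hat1$) with height function $h$, and let $H$ be the maximal value of $h$ on $P$. Then the sequence of matrices $(Z^{\times_q n})_{n\in\mathbb{Z}}$ is annihilated by $\Delta_q^{H+1}$, and for all $n\in\mathbb{Z}$ the value $\mathsf{Z}_{P,h}([n]_q)$ is the coefficient of index $(\hat0,\hat1)$ of the matrix $Z^{\times_q n}$.
   Context: Let $q$ be an indeterminate and $[n]_q=(q^n-1)/(q-1)$ for $n\in\mathbb{Z}$. A height function on $P$ is $h:P\to\mathbb{N}$ with $h(x)<h(y)$ whenever $y$ covers $x$. The $q$-Zeta polynomial $\mathsf{Z}_{P,h}(x)\in\mathbb{Q}(q)[x]$ is the unique polynomial such that for every integer $n\ge2$, $\mathsf{Z}_{P,h}([n]_q)=\sum_{e_1\le\cdots\le e_{n-1}}q^{h(e_1)+\cdots+h(e_{n-1})}$, summed over all weakly increasing sequences of $n-1$ elements of $P$. Let $\operatorname{Inc}_q(P,h)$ be the set of square matrices $A$ indexed by $P\times P$ with entries in $\mathbb{Z}[q,q^{ -1}]$ such that $A_{x,y}=0$ unless $x\le y$. Let $D_h$ be the diagonal matrix with entries $q^{h(x)}$, $x\in P$. Define the product $A\times_q B=A\,D_h\,B$ (ordinary matrix products); it is associative with unit $D_h^{ -1}$. Let $Z$ be the zeta matrix: $Z_{x,y}=1$ if $x\le y$ and $0$ otherwise; it is invertible for $\times_q$, and $Z^{\times_q n}$ denotes its $n$-th power for $\times_q$, $n\in\mathbb{Z}$ (with $Z^{\times_q 0}=D_h^{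 -1}$). The operator $\Delta_q$ acts on sequences $(a_n)_{n\in\mathbb{Z}}$ (entrywise for sequences of matrices) by $(\Delta_q a)_n=(a_n-a_{n-1})/q^n$. -}

module Defs where

open import Data.Nat as ℕ using (ℕ; zero; suc)
open import Data.Integer as Int using (ℤ; +_; -[1+_]; 0ℤ; 1ℤ; -1ℤ)
open import Data.List using (List; []; _∷_; map)
open import Data.List.Relation.Unary.All using (All)
open import Data.Fin as Fin using (Fin)
open import Data.Product using (_×_)
open import Data.Sum using (_⊎_)
open import Relation.Binary.PropositionalEquality using (_≡_; _≢_)
open import Relation.Nullary using (¬_; Dec; yes; no)
open import Relation.Binary.Structures using (IsDecPartialOrder)

-- ℤ[q] : coefficient lists in the indeterminate q, constant term first

Poly : Set
Poly = List ℤ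

infixl 6 _⊕_
_⊕_ : Poly → Poly → Poly
[] ⊕ p = p
(a ∷ p) ⊕ [] = a ∷ p
(a ∷ p) ⊕ (b ∷ r) = (a Int.+ b) ∷ (p ⊕ r)

⊝_ : Poly → Poly
⊝ p = map Int.-_ p

scaleP : ℤ → Poly → Poly
scaleP a = map (a Int.*_)

infixl 7 _⊛_
_⊛_ : Poly → Poly → Poly
[] ⊛ r = []
(a ∷ p) ⊛ r = scaleP a r ⊕ (0ℤ ∷ (p ⊛ r))

IsZeroP : Poly → Set
IsZeroP p = All (_≡ 0ℤ) p

Xpow : ℕ → Poly
Xpow zero = 1ℤ ∷ []
Xpow (suc k) = 0ℤ ∷ Xpow k

-- ℚ(q) = Frac(ℤ[q]) : fractions num/den, equality by cross-multiplication

record ℚq : Set where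
  constructor _/_
  field
    num : Poly
    den : Poly
open ℚq public

Proper : ℚq → Set
Proper a = ¬ IsZeroP (den a)

infix 4 _≈_
_≈_ : ℚq → ℚq → Set
a ≈ b = IsZeroP ((num a ⊛ den b) ⊕ ⊝ (num b ⊛ den a))

0q 1q : ℚq
0q = [] / (1ℤ ∷ [])
1q = (1ℤ ∷ []) / (1ℤ ∷ [])

infixl 6 _+q_ _-q_
infixl 7 _*q_
_+q_ : ℚq → ℚq → ℚq
a +q b = ((num a ⊛ den b) ⊕ (num b ⊛ den a)) / (den a ⊛ den b)

-q_ : ℚq → ℚq
-q a = (⊝ num a) / den a

_-q_ : ℚq → ℚq → ℚq
a -q b = a +q (-q b)

_*q_ : ℚq → ℚq → ℚq
a *q b = (num a ⊛ num b) / (den a ⊛ den b)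

qpow : ℤ → ℚq
qpow (+ k) = Xpow k / (1ℤ ∷ [])
qpow -[1+ k ] = (1ℤ ∷ []) / Xpow (suc k)

qint : ℤ → ℚq
qint n = (qpow n -q 1q) *q ((1ℤ ∷ []) / (-1ℤ ∷ 1ℤ ∷ []))

-- polynomials in x with coefficients in ℚ(q) (constant coefficient first),
-- evaluated by Horner's rule
PolyX : Set
PolyX = List ℚq

evalX : PolyX → ℚq → ℚq
evalX [] t = 0q
evalX (c ∷ cs) t = c +q (t *q evalX cs t)

record FinBoundedPoset : Set₁ where
  field
    card  : ℕ
    _≼_   : Fin card → Fin card → Set
    isDPO : IsDecPartialOrder _≡_ _≼_
    bot   : Fin card
    top   : Fin card
    bot-min : ∀ x → bot ≼ x
    top-max : ∀ x → x ≼ top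
  _≼?_ = IsDecPartialOrder._≤?_ isDPO

size : FinBoundedPoset → ℕ
size = FinBoundedPoset.card

bot top : (P : FinBoundedPoset) → Fin (size P)
bot = FinBoundedPoset.bot
top = FinBoundedPoset.top

Covers : (P : FinBoundedPoset) → Fin (size P) → Fin (size P) → Set
Covers P x y = x ≼ y × x ≢ y × (∀ z → x ≼ z → z ≼ y → (z ≡ x) ⊎ (z ≡ y))
  where open FinBoundedPoset P

IsHeight : (P : FinBoundedPoset) → (Fin (size P) → ℕ) → Set
IsHeight P h = ∀ x y → Covers P x y → h x ℕ.< h y

sumF : ∀ {k} → (Fin k → ℚq) → ℚq
sumF {zero} f = 0q
sumF {suc k} f = f Fin.zero +q sumF (λ i → f (Fin.suc i))

ifDec : ∀ {A : Set} → Dec A → ℚq → ℚq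
ifDec (yes _) a = a
ifDec (no _) a = 0q

module _ (P : FinBoundedPoset) (h : Fin (size P) → ℕ) where
  open FinBoundedPoset P

  Mat : Set
  Mat = Fin card → Fin card → ℚq

  _·_ : Mat → Mat → Mat
  (A · B) x y = sumF (λ z → A x z *q B z y)

  _⊞_ : Mat → Mat → Mat
  (A ⊞ B) x y = A x y +q B x y

  Idm : Mat
  Idm x y = ifDec (x Fin.≟ y) 1q

  Dh : Mat
  Dh x y = ifDec (x Fin.≟ y) (qpow (+ h x))

  Dhinv : Mat
  Dhinv x y = ifDec (x Fin.≟ y) (qpow (Int.- (+ h x)))

  _×q_ : Mat → Mat → Mat
  A ×q B = (A · Dh) · B

  Zeta : Mat
  Zeta x y = ifDec (x ≼? y) 1q

  -- N = I - Z (nilpotent: N^card = 0), geom j = Σ_{i<j} N^i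
  Nm : Mat
  Nm x y = Idm x y -q Zeta x y

  geom : ℕ → Mat
  geom zero x y = 0q
  geom (suc j) = Idm ⊞ (Nm · geom j)

  -- ordinary inverse of Z is Σ_{i<card} N^i; the ×_q-inverse is D^{-1} Z^{-1} D^{-1}
  Zinv : Mat
  Zinv = (Dhinv · geom card) · Dhinv

  Zpow : ℤ → Mat
  Zpow (+ zero) = Dhinv
  Zpow (+ suc k) = Zpow (+ k) ×q Zeta
  Zpow -[1+ zero ] = Zinv
  Zpow -[1+ suc k ] = Zpow -[1+ k ] ×q Zinv

  Δq : (ℤ → Mat) → (ℤ → Mat)
  Δq a n x y = (a n x y -q a (n Int.- 1ℤ) x y) *q qpow (Int.- n)

  Δiter : ℕ → (ℤ → Mat) → (ℤ → Mat)
  Δiter zero a = a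
  Δiter (suc k) a = Δq (Δiter k a)

  -- S k x = Σ over x ≤ e₁ ≤ … ≤ e_k of q^{h e₁ + … + h e_k}
  chainsAbove : ℕ → Fin card → ℚq
  chainsAbove zero x = 1q
  chainsAbove (suc k) x = sumF (λ y → ifDec (x ≼? y) (qpow (+ h y) *q chainsAbove k y))

  -- Σ over all e₁ ≤ … ≤ e_k in P of q^{h e₁ + … + h e_k}
  multichainSum : ℕ → ℚq
  multichainSum zero = 1q
  multichainSum (suc k) = sumF (λ y → qpow (+ h y) *q chainsAbove k y)

  IsQZeta : PolyX → Set
  IsQZeta f = All Proper f × (∀ n → 2 ℕ.≤ n → evalX f (qint (+ n)) ≈ multichainSum (n ℕ.∸ 1))

module Submission where

-- Specialising q to an integer m ≥ 2 turns every entry of Z^{×_q n}, every iterate of Δ_q and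
-- every value of a q-Zeta polynomial into a rational number, and a polynomial with integer
-- coefficients that vanishes at all large integers is zero; so both claims reduce to identities
-- in ℚ for all large m. There, Δ_q^k a_n = q^{-kn} (1 - q^{k-1} S) ⋯ (1 - q S) (1 - S) a_n, with S
-- the shift a_n ↦ a_{n-1}. By Z^{×_q n} = Z^{×_q (n-1)} ×_q Z, the factor 1 - q^{h y} S sends the
-- column y of Z^{×_q n} to a combination of shifted columns w < y; as h w < h y, induction on h y
-- shows that column y is annihilated by the first h y + 1 factors, hence by the first H + 1.
-- Multiplication by [n]_q costs one more factor, so the difference between Z_{P,h}([n]_q) and the
-- (0̂,1̂) entry is annihilated by finitely many factors; it vanishes for n ≥ 2, where the entry
-- counts multichains, and the factors are invertible on sequences vanishing from some point on.

open import Algebra.Bundles using (CommutativeRing)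
open import Data.Bool using (Bool; true; false; T; if_then_else_)
open import Data.Empty using (⊥-elim)
open import Data.Fin as Fin using (Fin)
import Data.Fin.Properties as FinP
open import Data.Integer as ℤ using (ℤ; +_; -[1+_]; 0ℤ; 1ℤ; -1ℤ; ∣_∣)
import Data.Integer.Properties as ℤP
open import Data.Integer.Solver using () renaming (module +-*-Solver to ℤ-Solver)
open import Data.List using (List; []; _∷_; length)
open import Data.List.Relation.Unary.All as All using (All; []; _∷_)
open import Data.Nat as ℕ using (ℕ; zero; suc; _≤_; _<_)
import Data.Nat.Properties as ℕP
open import Data.Product using (Σ; ∃; _×_; _,_)
open import Data.Rational as ℚ using (ℚ; 0ℚ; 1ℚ)
open import Data.Rational.Literals using (fromℤ)
import Data.Rational.Properties as ℚP
open import Data.Rational.Solver using () renaming (module +-*-Solver to ℚ-Solver)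
open import Data.Rational.Unnormalised using (*≡*)
import Data.Rational.Unnormalised.Properties as ℚᵘP
open import Data.Sum using (_⊎_; inj₁; inj₂)
open import Data.Unit using (tt)
open import Function using (_∘_; _∘′_)
open import Relation.Binary.Bundles using (Setoid)
import Relation.Binary.Reasoning.Setoid as SetoidReasoning
open import Relation.Binary.PropositionalEquality
open import Relation.Binary.Structures using (IsDecPartialOrder)
open import Relation.Nullary using (¬_; Dec; yes; no)
open import Relation.Nullary.Decidable using (isYes; toWitness; fromWitness)

open import Algebra.Properties.CommutativeSemiring.Exp (CommutativeRing.commutativeSemiring ℚP.+-*-commutativeRing)
  using (_^_; ^-distrib-*)
open import Algebra.Properties.Semiring.Sum (CommutativeRing.semiring ℚP.+-*-commutativeRing)
  using (sum; sum-syntax; sum-cong-≗; sum-replicate-zero; ∑-distrib-+; ∑-comm; *-distribˡ-sum; *-distribʳ-sum)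
open import Algebra.Properties.Group ℚP.+-0-group using () renaming (x∙y⁻¹≈ε⇒x≈y to p-q≡0⇒p≡q)

open import Defs using (Poly; _⊕_; ⊝_; scaleP; _⊛_; IsZeroP; Xpow; ℚq; num; den; Proper; _≈_; 0q; 1q; _+q_; -q_; _*q_; qpow; qint; PolyX; evalX; sumF; FinBoundedPoset; size; IsHeight; module FinBoundedPoset)
import Defs as D

evalℤ : Poly → ℤ → ℤ
evalℤ [] x = 0ℤ
evalℤ (a ∷ p) x = a ℤ.+ x ℤ.* evalℤ p x

module _ where
  open ℤ-Solver

  evalℤ-⊕ : ∀ p r x → evalℤ (p ⊕ r) x ≡ evalℤ p x ℤ.+ evalℤ r x
  evalℤ-⊕ [] r x = sym (ℤP.+-identityˡ _)
  evalℤ-⊕ (a ∷ p) [] x = sym (ℤP.+-identityʳ _)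
  evalℤ-⊕ (a ∷ p) (b ∷ r) x rewrite evalℤ-⊕ p r x =
    solve 5 (λ a b x u v → a :+ b :+ x :* (u :+ v) := a :+ x :* u :+ (b :+ x :* v)) refl a b x (evalℤ p x) (evalℤ r x)

  evalℤ-⊝ : ∀ p x → evalℤ (⊝ p) x ≡ ℤ.- evalℤ p x
  evalℤ-⊝ [] x = refl
  evalℤ-⊝ (a ∷ p) x rewrite evalℤ-⊝ p x =
    solve 3 (λ a x u → :- a :+ x :* (:- u) := :- (a :+ x :* u)) refl a x (evalℤ p x)

  evalℤ-scaleP : ∀ c p x → evalℤ (scaleP c p) x ≡ c ℤ.* evalℤ p x
  evalℤ-scaleP c [] x = sym (ℤP.*-zeroʳ c)
  evalℤ-scaleP c (a ∷ p) x rewrite evalℤ-scaleP c p x =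
    solve 4 (λ c a x u → c :* a :+ x :* (c :* u) := c :* (a :+ x :* u)) refl c a x (evalℤ p x)

  evalℤ-⊛ : ∀ p r x → evalℤ (p ⊛ r) x ≡ evalℤ p x ℤ.* evalℤ r x
  evalℤ-⊛ [] r x = refl
  evalℤ-⊛ (a ∷ p) r x rewrite evalℤ-⊕ (scaleP a r) (0ℤ ∷ (p ⊛ r)) x | evalℤ-scaleP a r x | evalℤ-⊛ p r x =
    solve 4 (λ a x u v → a :* v :+ (con 0ℤ :+ x :* (u :* v)) := (a :+ x :* u) :* v) refl a x (evalℤ p x) (evalℤ r x)

evalℤ-Xpow : ∀ k x → evalℤ (Xpow k) x ≡ x ℤ.^ k
evalℤ-Xpow zero x rewrite ℤP.*-zeroʳ x = refl
evalℤ-Xpow (suc k) x rewrite evalℤ-Xpow k x = ℤP.+-identityˡ _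

evalℤ-IsZeroP : ∀ {p} x → IsZeroP p → evalℤ p x ≡ 0ℤ
evalℤ-IsZeroP x [] = refl
evalℤ-IsZeroP x (refl ∷ z) rewrite evalℤ-IsZeroP x z | ℤP.*-zeroʳ x = refl

a+m*e≡0⇒e≡0 : ∀ a e m → ∣ a ∣ ℕ.< m → a ℤ.+ + m ℤ.* e ≡ 0ℤ → e ≡ 0ℤ
a+m*e≡0⇒e≡0 a e m ∣a∣<m a+me≡0 =
  ℤP.∣i∣≡0⇒i≡0 {e} (ℕP.n<1⇒n≡0 (ℕP.*-cancelˡ-< m ∣ e ∣ 1 m*∣e∣<m*1))
  where
  a≡-me : a ≡ ℤ.- (+ m ℤ.* e)
  a≡-me = ℤP.i-j≡0⇒i≡j a _ (trans (cong (λ x → a ℤ.+ x) (ℤP.neg-involutive _)) a+me≡0)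
  m*∣e∣<m*1 : m ℕ.* ∣ e ∣ ℕ.< m ℕ.* 1
  m*∣e∣<m*1 = subst₂ ℕ._<_ (trans (cong ∣_∣ a≡-me) (trans (ℤP.∣-i∣≡∣i∣ (+ m ℤ.* e)) (ℤP.abs-* (+ m) e)))
                          (sym (ℕP.*-identityʳ m)) ∣a∣<m

a+m*e≡0⇒a≡0 : ∀ a e m → ∣ a ∣ ℕ.< m → a ℤ.+ + m ℤ.* e ≡ 0ℤ → a ≡ 0ℤ
a+m*e≡0⇒a≡0 a e m ∣a∣<m a+me≡0 = begin
  a                    ≡˘⟨ ℤP.+-identityʳ a ⟩
  a ℤ.+ 0ℤ             ≡˘⟨ cong (λ x → a ℤ.+ x) (ℤP.*-zeroʳ (+ m)) ⟩
  a ℤ.+ + m ℤ.* 0ℤ     ≡˘⟨ cong (λ e → a ℤ.+ + m ℤ.* e) (a+m*e≡0⇒e≡0 a e m ∣a∣<m a+me≡0) ⟩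
  a ℤ.+ + m ℤ.* e      ≡⟨ a+me≡0 ⟩
  0ℤ                   ∎
  where open ≡-Reasoning

eventuallyRoot⇒IsZeroP : ∀ p K → (∀ m → K ℕ.≤ m → evalℤ p (+ m) ≡ 0ℤ) → IsZeroP p
eventuallyRoot⇒IsZeroP [] K roots = []
eventuallyRoot⇒IsZeroP (a ∷ p) K roots = a≡0 ∷ eventuallyRoot⇒IsZeroP p (suc K) tailRoots
  where
  m₀ = K ℕ.+ suc ∣ a ∣
  a≡0 : a ≡ 0ℤ
  a≡0 = a+m*e≡0⇒a≡0 a _ m₀ (ℕP.m≤n+m (suc ∣ a ∣) K) (roots m₀ (ℕP.m≤m+n K _))
  tailRoots : ∀ m → suc K ℕ.≤ m → evalℤ p (+ m) ≡ 0ℤ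
  tailRoots (suc m) (ℕ.s≤s K≤m) =
    a+m*e≡0⇒e≡0 0ℤ _ (suc m) (ℕ.s≤s ℕ.z≤n) (trans (cong (λ a → a ℤ.+ _) (sym a≡0)) (roots (suc m) (ℕP.m≤n⇒m≤1+n K≤m)))

¬IsZeroP⇒eventuallyNonroot : ∀ p → ¬ IsZeroP p → Σ ℕ λ K → ∀ m → K ℕ.≤ m → evalℤ p (+ m) ≢ 0ℤ
¬IsZeroP⇒eventuallyNonroot [] p≢0 = ⊥-elim (p≢0 [])
¬IsZeroP⇒eventuallyNonroot (a ∷ p) ap≢0 with All.all? (ℤ._≟ 0ℤ) p
... | yes p≡0 = 0 , λ m _ ap[m]≡0 → ap≢0 (a≡0 m ap[m]≡0 ∷ p≡0)
  where
  a≡0 : ∀ m → evalℤ (a ∷ p) (+ m) ≡ 0ℤ → a ≡ 0ℤ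
  a≡0 m eq rewrite evalℤ-IsZeroP (+ m) p≡0 | ℤP.*-zeroʳ (+ m) | ℤP.+-identityʳ a = eq
... | no p≢0 with ¬IsZeroP⇒eventuallyNonroot p p≢0
... | K , nonroot = K ℕ.+ suc ∣ a ∣ , λ m K'≤m ap[m]≡0 →
  nonroot m (ℕP.≤-trans (ℕP.m≤m+n K _) K'≤m) (a+m*e≡0⇒e≡0 a _ m (ℕP.≤-trans (ℕP.m≤n+m _ K) K'≤m) ap[m]≡0)

fromℤ-+ : ∀ a b → fromℤ (a ℤ.+ b) ≡ fromℤ a ℚ.+ fromℤ b
fromℤ-+ a b = ℚP.toℚᵘ-injective (ℚᵘP.≃-sym (ℚᵘP.≃-trans (ℚP.toℚᵘ-homo-+ (fromℤ a) (fromℤ b))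
  (*≡* (cong₂ (λ x y → (x ℤ.+ y) ℤ.* 1ℤ) (ℤP.*-identityʳ a) (ℤP.*-identityʳ b)))))

fromℤ-* : ∀ a b → fromℤ (a ℤ.* b) ≡ fromℤ a ℚ.* fromℤ b
fromℤ-* a b = ℚP.toℚᵘ-injective (ℚᵘP.≃-sym (ℚᵘP.≃-trans (ℚP.toℚᵘ-homo-* (fromℤ a) (fromℤ b)) (*≡* refl)))

fromℤ-neg : ∀ a → fromℤ (ℤ.- a) ≡ ℚ.- fromℤ a
fromℤ-neg a = ℚP.toℚᵘ-injective (ℚᵘP.≃-sym (ℚᵘP.≃-trans (ℚP.toℚᵘ-homo‿- (fromℤ a)) (*≡* refl)))

fromℤ-injective : ∀ {a b} → fromℤ a ≡ fromℤ b → a ≡ b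
fromℤ-injective {a} {b} eq with ℚP.toℚᵘ-cong eq
... | *≡* a*1≡b*1 = trans (sym (ℤP.*-identityʳ a)) (trans a*1≡b*1 (ℤP.*-identityʳ b))

fromℤ-^ : ∀ x k → fromℤ (x ℤ.^ k) ≡ fromℤ x ^ k
fromℤ-^ x zero = refl
fromℤ-^ x (suc k) = trans (fromℤ-* x (x ℤ.^ k)) (cong (fromℤ x ℚ.*_) (fromℤ-^ x k))

fromℤ-≢0 : ∀ {z} → z ≢ 0ℤ → fromℤ z ≢ 0ℚ
fromℤ-≢0 z≢0 eq = z≢0 (fromℤ-injective eq)

*-≢0 : ∀ {i j} → i ≢ 0ℤ → j ≢ 0ℤ → i ℤ.* j ≢ 0ℤ
*-≢0 {i} i≢0 j≢0 ij≡0 with ℤP.i*j≡0⇒i≡0∨j≡0 i ij≡0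
... | inj₁ i≡0 = i≢0 i≡0
... | inj₂ j≡0 = j≢0 j≡0

open ℚ-Solver using (solve; _:=_; _:+_; _:*_; _:-_; :-_; con)

∑-zero : ∀ {k} (f : Fin k → ℚ) → (∀ i → f i ≡ 0ℚ) → sum f ≡ 0ℚ
∑-zero {k} f f≗0 = trans (sum-cong-≗ f≗0) (sum-replicate-zero k)

∑-δ : ∀ {k} (f : Fin k → ℚ) x → (∀ z → z ≢ x → f z ≡ 0ℚ) → sum f ≡ f x
∑-δ f Fin.zero off = trans (cong (f Fin.zero ℚ.+_) (∑-zero _ (λ i → off (Fin.suc i) λ ()))) (ℚP.+-identityʳ _)
∑-δ f (Fin.suc x) off =
  trans (cong₂ ℚ._+_ (off Fin.zero λ ()) (∑-δ (λ i → f (Fin.suc i)) x λ z z≢x → off (Fin.suc z) (z≢x ∘′ FinP.suc-injective)))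
        (ℚP.+-identityˡ _)

∑-distrib-minus : ∀ {k} (f g : Fin k → ℚ) → ∑[ i < k ] (f i ℚ.- g i) ≡ sum f ℚ.- sum g
∑-distrib-minus {zero} f g = refl
∑-distrib-minus {suc k} f g = trans (cong (f Fin.zero ℚ.- g Fin.zero ℚ.+_) (∑-distrib-minus (f ∘′ Fin.suc) (g ∘′ Fin.suc)))
  (solve 4 (λ a b c d → a :- b :+ (c :- d) := a :+ c :- (b :+ d)) refl (f Fin.zero) (g Fin.zero) (sum (f ∘′ Fin.suc)) (sum (g ∘′ Fin.suc)))

^-inverse : ∀ a b k → a ℚ.* b ≡ 1ℚ → a ^ k ℚ.* b ^ k ≡ 1ℚ
^-inverse a b k a*b≡1 = trans (sym (^-distrib-* a b k)) (trans (cong (_^ k) a*b≡1) (one^ k))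
  where
  one^ : ∀ k → 1ℚ ^ k ≡ 1ℚ
  one^ zero = refl
  one^ (suc k) = trans (ℚP.*-identityˡ _) (one^ k)

*-cancelʳ-0 : ∀ x d → d ≢ 0ℚ → x ℚ.* d ≡ 0ℚ → x ≡ 0ℚ
*-cancelʳ-0 x d d≢0 xd≡0 = begin
  x                          ≡˘⟨ ℚP.*-identityʳ x ⟩
  x ℚ.* 1ℚ                   ≡˘⟨ cong (x ℚ.*_) (ℚP.*-inverseʳ d) ⟩
  x ℚ.* (d ℚ.* ℚ.1/ d)       ≡˘⟨ ℚP.*-assoc x d (ℚ.1/ d) ⟩
  x ℚ.* d ℚ.* ℚ.1/ d         ≡⟨ cong (ℚ._* ℚ.1/ d) xd≡0 ⟩
  0ℚ ℚ.* ℚ.1/ d              ≡⟨ ℚP.*-zeroˡ (ℚ.1/ d) ⟩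
  0ℚ                         ∎
  where
  open ≡-Reasoning
  instance _ = ℚ.≢-nonZero d≢0

n-1+1≡n : ∀ n → n ℤ.- 1ℤ ℤ.+ 1ℤ ≡ n
n-1+1≡n n = trans (ℤP.+-assoc n -1ℤ 1ℤ) (ℤP.+-identityʳ n)

n+1-1≡n : ∀ n → n ℤ.+ 1ℤ ℤ.- 1ℤ ≡ n
n+1-1≡n n = trans (ℤP.+-assoc n 1ℤ -1ℤ) (ℤP.+-identityʳ n)

Seq : Set
Seq = ℤ → ℚ

descend : ∀ (P : ℤ → Set) N → (∀ n → P (n ℤ.+ 1ℤ) → P n) → (∀ j → P (+ (N ℕ.+ j))) → ∀ n → P n
descend P N step above = everywhere
  where
  nonneg : ∀ d j → N ℕ.≤ d ℕ.+ j → P (+ j)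
  nonneg zero j N≤j = subst (P ∘′ +_) (ℕP.m+[n∸m]≡n N≤j) (above (j ℕ.∸ N))
  nonneg (suc d) j N≤d+1+j =
    step (+ j) (subst (λ k → P (+ k)) (ℕP.+-comm 1 j) (nonneg d (suc j) (subst (N ℕ.≤_) (sym (ℕP.+-suc d j)) N≤d+1+j)))
  negative : ∀ k → P -[1+ k ]
  negative zero = step -[1+ 0 ] (nonneg N 0 (ℕP.m≤m+n N 0))
  negative (suc k) = step -[1+ suc k ] (negative k)
  everywhere : ∀ n → P n
  everywhere (+ j) = nonneg N j (ℕP.m≤m+n N j)
  everywhere -[1+ k ] = negative k

module QDifferences (t t⁻¹ s : ℚ) (t⁻¹*t≡1 : t⁻¹ ℚ.* t ≡ 1ℚ) where

  tpow : ℤ → ℚ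
  tpow (+ k) = t ^ k
  tpow -[1+ k ] = t⁻¹ ^ suc k

  -- [n]_t when s = 1/(t - 1); the annihilation lemmas hold for every s
  tint : ℤ → ℚ
  tint n = (tpow n ℚ.- 1ℚ) ℚ.* s

  t⁻¹-cancel : ∀ u → t⁻¹ ℚ.* u ℚ.* t ≡ u
  t⁻¹-cancel u = begin
    t⁻¹ ℚ.* u ℚ.* t   ≡⟨ solve 3 (λ a u b → a :* u :* b := u :* (a :* b)) refl t⁻¹ u t ⟩
    u ℚ.* (t⁻¹ ℚ.* t) ≡⟨ cong (u ℚ.*_) t⁻¹*t≡1 ⟩
    u ℚ.* 1ℚ          ≡⟨ ℚP.*-identityʳ u ⟩
    u                 ∎
    where open ≡-Reasoning

  tpow-suc : ∀ n → tpow (n ℤ.+ 1ℤ) ≡ tpow n ℚ.* t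
  tpow-suc (+ k) rewrite ℕP.+-comm k 1 = ℚP.*-comm t (t ^ k)
  tpow-suc -[1+ zero ] = sym (t⁻¹-cancel 1ℚ)
  tpow-suc -[1+ suc k ] = sym (t⁻¹-cancel (t⁻¹ ^ suc k))

  tpow-pred : ∀ n → tpow (n ℤ.- 1ℤ) ℚ.* t ≡ tpow n
  tpow-pred n = trans (sym (tpow-suc (n ℤ.- 1ℤ))) (cong tpow (n-1+1≡n n))

  tpow-neg-pred : ∀ n → tpow (ℤ.- (n ℤ.- 1ℤ)) ≡ tpow (ℤ.- n) ℚ.* t
  tpow-neg-pred n = trans (cong tpow (ℤP.neg-distrib-+ n -1ℤ)) (tpow-suc (ℤ.- n))

  diff : ℕ → Seq → Seq
  diff k b n = b n ℚ.- t ^ k ℚ.* b (n ℤ.- 1ℤ)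

  diffs : ℕ → ℕ → Seq → Seq
  diffs j zero b = b
  diffs j (suc M) b = diff (j ℕ.+ M) (diffs j M b)

  record Annihilated (M : ℕ) (b : Seq) : Set where
    constructor annihilated
    field vanishes : ∀ n → diffs 0 M b n ≡ 0ℚ
  open Annihilated public

  diff-cong : ∀ k {b b′} → (∀ n → b n ≡ b′ n) → ∀ n → diff k b n ≡ diff k b′ n
  diff-cong k b≗b′ n = cong₂ (λ x y → x ℚ.- t ^ k ℚ.* y) (b≗b′ n) (b≗b′ (n ℤ.- 1ℤ))

  diffs-cong : ∀ j M {b b′} → (∀ n → b n ≡ b′ n) → ∀ n → diffs j M b n ≡ diffs j M b′ n
  diffs-cong j zero b≗b′ = b≗b′
  diffs-cong j (suc M) b≗b′ = diff-cong (j ℕ.+ M) (diffs-cong j M b≗b′)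

  diff-comm : ∀ k l b n → diff k (diff l b) n ≡ diff l (diff k b) n
  diff-comm k l b n = solve 5 (λ x y b₀ b₁ b₂ → b₀ :- y :* b₁ :- x :* (b₁ :- y :* b₂) := b₀ :- x :* b₁ :- y :* (b₁ :- x :* b₂))
    refl (t ^ k) (t ^ l) (b n) (b (n ℤ.- 1ℤ)) (b (n ℤ.- 1ℤ ℤ.- 1ℤ))

  diffs-diff : ∀ j M k b n → diffs j M (diff k b) n ≡ diff k (diffs j M b) n
  diffs-diff j zero k b n = refl
  diffs-diff j (suc M) k b n = trans (diff-cong (j ℕ.+ M) (diffs-diff j M k b) n) (diff-comm (j ℕ.+ M) k (diffs j M b) n)

  diffs-+ : ∀ j M b b′ n → diffs j M (λ n → b n ℚ.+ b′ n) n ≡ diffs j M b n ℚ.+ diffs j M b′ n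
  diffs-+ j zero b b′ n = refl
  diffs-+ j (suc M) b b′ n = trans (diff-cong (j ℕ.+ M) (diffs-+ j M b b′) n)
    (solve 5 (λ x a b c d → a :+ b :- x :* (c :+ d) := (a :- x :* c) :+ (b :- x :* d)) refl
      (t ^ (j ℕ.+ M)) (diffs j M b n) (diffs j M b′ n) (diffs j M b (n ℤ.- 1ℤ)) (diffs j M b′ (n ℤ.- 1ℤ)))

  diffs-* : ∀ j M c b n → diffs j M (λ n → c ℚ.* b n) n ≡ c ℚ.* diffs j M b n
  diffs-* j zero c b n = refl
  diffs-* j (suc M) c b n = trans (diff-cong (j ℕ.+ M) (diffs-* j M c b) n)
    (solve 4 (λ x c a d → c :* a :- x :* (c :* d) := c :* (a :- x :* d)) refl
      (t ^ (j ℕ.+ M)) c (diffs j M b n) (diffs j M b (n ℤ.- 1ℤ)))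

  diffs-shift : ∀ j M b n → diffs j M (λ n → b (n ℤ.- 1ℤ)) n ≡ diffs j M b (n ℤ.- 1ℤ)
  diffs-shift j zero b n = refl
  diffs-shift j (suc M) b n = diff-cong (j ℕ.+ M) (diffs-shift j M b) n

  diffs-split : ∀ M b n → diffs 0 (suc M) b n ≡ diffs 1 M (diff 0 b) n
  diffs-split zero b n = refl
  diffs-split (suc M) b n = diff-cong (suc M) (diffs-split M b) n

  diffs-tpow : ∀ j M b n → diffs (suc j) M (λ n → tpow n ℚ.* b n) n ≡ tpow n ℚ.* diffs j M b n
  diffs-tpow j zero b n = refl
  diffs-tpow j (suc M) b n = begin
    diff (suc (j ℕ.+ M)) (diffs (suc j) M (λ n → tpow n ℚ.* b n)) n
      ≡⟨ diff-cong (suc (j ℕ.+ M)) (diffs-tpow j M b) n ⟩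
    tpow n ℚ.* c n ℚ.- t ℚ.* t ^ (j ℕ.+ M) ℚ.* (tpow (n ℤ.- 1ℤ) ℚ.* c (n ℤ.- 1ℤ))
      ≡⟨ cong (λ w → w ℚ.* c n ℚ.- t ℚ.* t ^ (j ℕ.+ M) ℚ.* (tpow (n ℤ.- 1ℤ) ℚ.* c (n ℤ.- 1ℤ))) (sym (tpow-pred n)) ⟩
    tpow (n ℤ.- 1ℤ) ℚ.* t ℚ.* c n ℚ.- t ℚ.* t ^ (j ℕ.+ M) ℚ.* (tpow (n ℤ.- 1ℤ) ℚ.* c (n ℤ.- 1ℤ))
      ≡⟨ solve 5 (λ a t x y₀ y₁ → a :* t :* y₀ :- t :* x :* (a :* y₁) := a :* t :* (y₀ :- x :* y₁)) refl
           (tpow (n ℤ.- 1ℤ)) t (t ^ (j ℕ.+ M)) (c n) (c (n ℤ.- 1ℤ)) ⟩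
    tpow (n ℤ.- 1ℤ) ℚ.* t ℚ.* diff (j ℕ.+ M) c n
      ≡⟨ cong (ℚ._* diff (j ℕ.+ M) c n) (tpow-pred n) ⟩
    tpow n ℚ.* diff (j ℕ.+ M) c n ∎
    where
    open ≡-Reasoning
    c = diffs j M b

  diff-zero : ∀ k {b} → (∀ n → b n ≡ 0ℚ) → ∀ n → diff k b n ≡ 0ℚ
  diff-zero k {b} b≗0 n rewrite b≗0 n | b≗0 (n ℤ.- 1ℤ) = solve 1 (λ x → con 0ℚ :- x :* con 0ℚ := con 0ℚ) refl (t ^ k)

  annihilated-cong : ∀ {M b b′} → (∀ n → b n ≡ b′ n) → Annihilated M b → Annihilated M b′
  annihilated-cong {M} b≗b′ (annihilated ann) = annihilated λ n → trans (sym (diffs-cong 0 M b≗b′ n)) (ann n)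

  annihilated-suc : ∀ {M b} → Annihilated M b → Annihilated (suc M) b
  annihilated-suc {M} (annihilated ann) = annihilated (diff-zero M ann)

  annihilated-≤ : ∀ {M M′ b} → M ℕ.≤ M′ → Annihilated M b → Annihilated M′ b
  annihilated-≤ M≤M′ = raise (ℕP.≤⇒≤′ M≤M′)
    where
    raise : ∀ {M M′ b} → M ℕ.≤′ M′ → Annihilated M b → Annihilated M′ b
    raise ℕ.≤′-refl ann = ann
    raise (ℕ.≤′-step M≤′M′) ann = annihilated-suc (raise M≤′M′ ann)

  annihilated-0 : ∀ M → Annihilated M (λ _ → 0ℚ)
  annihilated-0 M = annihilated-≤ ℕ.z≤n (annihilated λ _ → refl)

  annihilated-const : ∀ c → Annihilated 1 (λ _ → c)
  annihilated-const c = annihilated λ n → solve 1 (λ c → c :- con 1ℚ :* c := con 0ℚ) refl c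

  annihilated-+ : ∀ {M b b′} → Annihilated M b → Annihilated M b′ → Annihilated M (λ n → b n ℚ.+ b′ n)
  annihilated-+ {M} {b} {b′} (annihilated ann) (annihilated ann′) =
    annihilated λ n → trans (diffs-+ 0 M b b′ n) (cong₂ ℚ._+_ (ann n) (ann′ n))

  annihilated-* : ∀ {M b} c → Annihilated M b → Annihilated M (λ n → c ℚ.* b n)
  annihilated-* {M} {b} c (annihilated ann) =
    annihilated λ n → trans (diffs-* 0 M c b n) (trans (cong (c ℚ.*_) (ann n)) (ℚP.*-zeroʳ c))

  annihilated-minus : ∀ {M b b′} → Annihilated M b → Annihilated M b′ → Annihilated M (λ n → b n ℚ.- b′ n)
  annihilated-minus {M} {b} {b′} ann ann′ = annihilated-cong (λ n → solve 2 (λ x y → x :+ (:- con 1ℚ) :* y := x :- y) refl (b n) (b′ n))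
    (annihilated-+ ann (annihilated-* (ℚ.- 1ℚ) ann′))

  annihilated-∑ : ∀ {M K} (b : Fin K → Seq) → (∀ z → Annihilated M (b z)) → Annihilated M (λ n → ∑[ z < K ] b z n)
  annihilated-∑ {M} {zero} b ann = annihilated-0 M
  annihilated-∑ {M} {suc K} b ann = annihilated-+ (ann Fin.zero) (annihilated-∑ (λ z → b (Fin.suc z)) (λ z → ann (Fin.suc z)))

  annihilated-shift : ∀ {M b} → Annihilated M b → Annihilated M (λ n → b (n ℤ.- 1ℤ))
  annihilated-shift {M} {b} (annihilated ann) = annihilated λ n → trans (diffs-shift 0 M b n) (ann (n ℤ.- 1ℤ))

  annihilated-diff : ∀ {M} b → Annihilated M (diff M b) → Annihilated (suc M) b
  annihilated-diff {M} b (annihilated ann) = annihilated λ n → trans (sym (diffs-diff 0 M M b n)) (ann n)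

  annihilated-diff⁻ : ∀ {M} b → Annihilated (suc M) b → Annihilated M (diff M b)
  annihilated-diff⁻ {M} b (annihilated ann) = annihilated λ n → trans (diffs-diff 0 M M b n) (ann n)

  annihilated-tpow : ∀ {M b} → Annihilated M b → Annihilated (suc M) (λ n → tpow n ℚ.* b n)
  annihilated-tpow {M} {b} (annihilated ann) = annihilated λ n → begin
    diffs 0 (suc M) tb n      ≡⟨ diffs-split M tb n ⟩
    diffs 1 M (diff 0 tb) n   ≡⟨ diffs-diff 1 M 0 tb n ⟩
    diff 0 (diffs 1 M tb) n   ≡⟨ diff-zero 0 (λ n → trans (diffs-tpow 0 M b n) (trans (cong (tpow n ℚ.*_) (ann n)) (ℚP.*-zeroʳ (tpow n)))) n ⟩
    0ℚ                        ∎
    where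
    open ≡-Reasoning
    tb = λ n → tpow n ℚ.* b n

  annihilated-tint : ∀ {M b} → Annihilated M b → Annihilated (suc M) (λ n → tint n ℚ.* b n)
  annihilated-tint {M} {b} ann = annihilated-cong
    (λ n → solve 3 (λ q s b → s :* (q :* b) :+ (:- s) :* b := (q :- con 1ℚ) :* s :* b) refl (tpow n) s (b n))
    (annihilated-+ (annihilated-* s (annihilated-tpow ann)) (annihilated-* (ℚ.- s) (annihilated-suc ann)))

  evalPoly : List ℚ → ℚ → ℚ
  evalPoly [] x = 0ℚ
  evalPoly (c ∷ cs) x = c ℚ.+ x ℚ.* evalPoly cs x

  annihilated-evalPoly : ∀ f → Annihilated (length f) (λ n → evalPoly f (tint n))
  annihilated-evalPoly [] = annihilated-0 0
  annihilated-evalPoly (c ∷ f) =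
    annihilated-+ (annihilated-≤ (ℕ.s≤s ℕ.z≤n) (annihilated-const c)) (annihilated-tint (annihilated-evalPoly f))

  t^-cancel : ∀ k x → t ^ k ℚ.* x ≡ 0ℚ → x ≡ 0ℚ
  t^-cancel k x t^kx≡0 = begin
    x                            ≡˘⟨ ℚP.*-identityˡ x ⟩
    1ℚ ℚ.* x                     ≡˘⟨ cong (ℚ._* x) (^-inverse t⁻¹ t k t⁻¹*t≡1) ⟩
    t⁻¹ ^ k ℚ.* t ^ k ℚ.* x      ≡⟨ ℚP.*-assoc (t⁻¹ ^ k) (t ^ k) x ⟩
    t⁻¹ ^ k ℚ.* (t ^ k ℚ.* x)    ≡⟨ cong (t⁻¹ ^ k ℚ.*_) t^kx≡0 ⟩
    t⁻¹ ^ k ℚ.* 0ℚ               ≡⟨ ℚP.*-zeroʳ (t⁻¹ ^ k) ⟩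
    0ℚ                           ∎
    where open ≡-Reasoning

  annihilated∧eventually0⇒0 : ∀ {M} N b → Annihilated M b → (∀ j → b (+ (N ℕ.+ j)) ≡ 0ℚ) → ∀ n → b n ≡ 0ℚ
  annihilated∧eventually0⇒0 {zero} N b (annihilated ann) _ = ann
  annihilated∧eventually0⇒0 {suc M} N b ann b-eventually0 = descend (λ n → b n ≡ 0ℚ) N backwards b-eventually0
    where
    open ≡-Reasoning
    diff-b-eventually0 : ∀ j → diff M b (+ (suc N ℕ.+ j)) ≡ 0ℚ
    diff-b-eventually0 j = begin
      b (+ suc (N ℕ.+ j)) ℚ.- t ^ M ℚ.* b (+ (N ℕ.+ j))
        ≡⟨ cong₂ (λ x y → x ℚ.- t ^ M ℚ.* y) (trans (cong (b ∘′ +_) (sym (ℕP.+-suc N j))) (b-eventually0 (suc j))) (b-eventually0 j) ⟩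
      0ℚ ℚ.- t ^ M ℚ.* 0ℚ
        ≡⟨ solve 1 (λ x → con 0ℚ :- x :* con 0ℚ := con 0ℚ) refl (t ^ M) ⟩
      0ℚ ∎
    diff-b≡0 : ∀ n → diff M b n ≡ 0ℚ
    diff-b≡0 = annihilated∧eventually0⇒0 (suc N) (diff M b) (annihilated-diff⁻ b ann) diff-b-eventually0
    backwards : ∀ n → b (n ℤ.+ 1ℤ) ≡ 0ℚ → b n ≡ 0ℚ
    backwards n b[n+1]≡0 = subst (λ m → b m ≡ 0ℚ) (n+1-1≡n n) (t^-cancel M (b (n ℤ.+ 1ℤ ℤ.- 1ℤ)) (begin
      t ^ M ℚ.* b (n ℤ.+ 1ℤ ℤ.- 1ℤ)
        ≡⟨ solve 2 (λ a x → x := a :- (a :- x)) refl (b (n ℤ.+ 1ℤ)) (t ^ M ℚ.* b (n ℤ.+ 1ℤ ℤ.- 1ℤ)) ⟩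
      b (n ℤ.+ 1ℤ) ℚ.- diff M b (n ℤ.+ 1ℤ)
        ≡⟨ cong₂ ℚ._-_ b[n+1]≡0 (diff-b≡0 (n ℤ.+ 1ℤ)) ⟩
      0ℚ ∎))

count : ∀ {k} → (Fin k → Bool) → ℕ
count {zero} f = 0
count {suc k} f = (if f Fin.zero then 1 else 0) ℕ.+ count (λ i → f (Fin.suc i))

count≤k : ∀ {k} (f : Fin k → Bool) → count f ≤ k
count≤k {zero} f = ℕ.z≤n
count≤k {suc k} f with f Fin.zero
... | true = ℕ.s≤s (count≤k (λ i → f (Fin.suc i)))
... | false = ℕP.m≤n⇒m≤1+n (count≤k (λ i → f (Fin.suc i)))

count-pos : ∀ {k} (f : Fin k → Bool) w → T (f w) → 1 ≤ count f
count-pos f Fin.zero fw with f Fin.zero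
... | true = ℕ.s≤s ℕ.z≤n
count-pos f (Fin.suc w) fw = ℕP.≤-trans (count-pos (λ i → f (Fin.suc i)) w fw) (ℕP.m≤n+m _ _)

count-mono : ∀ {k} (f g : Fin k → Bool) → (∀ z → T (f z) → T (g z)) → count f ≤ count g
count-mono {zero} f g f⇒g = ℕ.z≤n
count-mono {suc k} f g f⇒g with f Fin.zero | g Fin.zero | f⇒g Fin.zero
... | true | true | _ = ℕ.s≤s (count-mono _ _ (λ z → f⇒g (Fin.suc z)))
... | true | false | f₀⇒g₀ = ⊥-elim (f₀⇒g₀ tt)
... | false | true | _ = ℕP.m≤n⇒m≤1+n (count-mono _ _ (λ z → f⇒g (Fin.suc z)))
... | false | false | _ = count-mono _ _ (λ z → f⇒g (Fin.suc z))

count-strict : ∀ {k} (f g : Fin k → Bool) → (∀ z → T (f z) → T (g z)) → ∀ w → T (g w) → ¬ T (f w) → count f < count g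
count-strict f g f⇒g Fin.zero gw ¬fw with f Fin.zero | g Fin.zero
... | true | _ = ⊥-elim (¬fw tt)
... | false | true = ℕ.s≤s (count-mono _ _ (λ z → f⇒g (Fin.suc z)))
count-strict f g f⇒g (Fin.suc w) gw ¬fw with f Fin.zero | g Fin.zero | f⇒g Fin.zero
... | true | true | _ = ℕ.s≤s (count-strict _ _ (λ z → f⇒g (Fin.suc z)) w gw ¬fw)
... | true | false | f₀⇒g₀ = ⊥-elim (f₀⇒g₀ tt)
... | false | true | _ = ℕP.m≤n⇒m≤1+n (count-strict _ _ (λ z → f⇒g (Fin.suc z)) w gw ¬fw)
... | false | false | _ = count-strict _ _ (λ z → f⇒g (Fin.suc z)) w gw ¬fw

module Rank (P : FinBoundedPoset) where
  open FinBoundedPoset P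
  open IsDecPartialOrder isDPO using () renaming (refl to ≼-refl; trans to ≼-trans; antisym to ≼-antisym)

  rank : Fin card → ℕ
  rank x = count (λ z → isYes (z ≼? x))

  rank-strictMono : ∀ {x y} → x ≼ y → x ≢ y → rank x < rank y
  rank-strictMono {x} {y} x≼y x≢y = count-strict _ _
    (λ z z≼x → fromWitness (≼-trans (toWitness z≼x) x≼y)) y (fromWitness ≼-refl)
    (λ y≼x → x≢y (≼-antisym x≼y (toWitness y≼x)))

  rank≤card : ∀ x → rank x ≤ card
  rank≤card x = count≤k _

  rank-pos : ∀ x → 1 ≤ rank x
  rank-pos x = count-pos _ x (fromWitness ≼-refl)

  StrictlyBetween : Fin card → Fin card → Fin card → Set
  StrictlyBetween x y z = (x ≼ z) × (z ≼ y) × (z ≢ x) × (z ≢ y)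

  strictlyBetween? : ∀ x y z → Dec (StrictlyBetween x y z)
  strictlyBetween? x y z with x ≼? z | z ≼? y | z Fin.≟ x | z Fin.≟ y
  ... | no x⋠z | _ | _ | _ = no λ (x≼z , _) → x⋠z x≼z
  ... | yes _ | no z⋠y | _ | _ = no λ (_ , z≼y , _) → z⋠y z≼y
  ... | yes _ | yes _ | yes z≡x | _ = no λ (_ , _ , z≢x , _) → z≢x z≡x
  ... | yes _ | yes _ | no _ | yes z≡y = no λ (_ , _ , _ , z≢y) → z≢y z≡y
  ... | yes x≼z | yes z≼y | no z≢x | no z≢y = yes (x≼z , z≼y , z≢x , z≢y)

  strictlyBelow? : ∀ x y → (x ≼ y × x ≢ y) ⊎ (x ≡ y ⊎ ¬ x ≼ y)
  strictlyBelow? x y with x Fin.≟ y | x ≼? y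
  ... | yes x≡y | _ = inj₂ (inj₁ x≡y)
  ... | no _ | no x⋠y = inj₂ (inj₂ x⋠y)
  ... | no x≢y | yes x≼y = inj₁ (x≼y , x≢y)

  -- Induction on the rank gap, splitting at an element strictly between x and y if there is one.
  height-strictMono : ∀ h → IsHeight P h → ∀ {x y} → x ≼ y → x ≢ y → h x < h y
  height-strictMono h isHeight {x} {y} = byGap (rank y) x y (ℕP.m≤n+m (rank y) (rank x))
    where
    byGap : ∀ d x y → rank y ≤ rank x ℕ.+ d → x ≼ y → x ≢ y → h x < h y
    byGap zero x y gap x≼y x≢y = ⊥-elim (ℕP.<⇒≱ (rank-strictMono x≼y x≢y) (subst (rank y ≤_) (ℕP.+-identityʳ _) gap))
    byGap (suc d) x y gap x≼y x≢y with FinP.any? (strictlyBetween? x y)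
    ... | yes (z , x≼z , z≼y , z≢x , z≢y) = ℕP.<-trans (byGap d x z gapˡ x≼z (z≢x ∘ sym)) (byGap d z y gapʳ z≼y z≢y)
      where
      gapˡ : rank z ≤ rank x ℕ.+ d
      gapˡ = ℕP.≤-pred (ℕP.≤-trans (rank-strictMono z≼y z≢y) (subst (rank y ≤_) (ℕP.+-suc (rank x) d) gap))
      gapʳ : rank y ≤ rank z ℕ.+ d
      gapʳ = ℕP.≤-trans gap (ℕP.≤-trans (ℕP.≤-reflexive (ℕP.+-suc (rank x) d)) (ℕP.+-monoˡ-≤ d (rank-strictMono x≼z (z≢x ∘ sym))))
    ... | no nothingBetween = isHeight x y (x≼y , x≢y , covers)
      where
      covers : ∀ z → x ≼ z → z ≼ y → (z ≡ x) ⊎ (z ≡ y)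
      covers z x≼z z≼y with z Fin.≟ x | z Fin.≟ y
      ... | yes z≡x | _ = inj₁ z≡x
      ... | no _ | yes z≡y = inj₂ z≡y
      ... | no z≢x | no z≢y = ⊥-elim (nothingBetween (z , x≼z , z≼y , z≢x , z≢y))

ifDec : ∀ {A : Set} → Dec A → ℚ → ℚ
ifDec (yes _) a = a
ifDec (no _) a = 0ℚ

ifDec-yes : ∀ {A : Set} (d : Dec A) {v} → A → ifDec d v ≡ v
ifDec-yes (yes _) _ = refl
ifDec-yes (no ¬a) a = ⊥-elim (¬a a)

ifDec-no : ∀ {A : Set} (d : Dec A) {v} → ¬ A → ifDec d v ≡ 0ℚ
ifDec-no (yes a) ¬a = ⊥-elim (¬a a)
ifDec-no (no _) _ = refl

ifDec-1* : ∀ {A : Set} (d : Dec A) v → ifDec d 1ℚ ℚ.* v ≡ ifDec d v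
ifDec-1* (yes _) v = ℚP.*-identityˡ v
ifDec-1* (no _) v = ℚP.*-zeroˡ v

-- The matrices and sums of Defs over ℚ instead of ℚ(q), with q specialised to t.
module Matrices (t t⁻¹ s : ℚ) (t⁻¹*t≡1 : t⁻¹ ℚ.* t ≡ 1ℚ) (P : FinBoundedPoset) (h : Fin (size P) → ℕ) where
  open FinBoundedPoset P
  open IsDecPartialOrder isDPO using () renaming (refl to ≼-refl)
  open QDifferences t t⁻¹ s t⁻¹*t≡1
  open Rank P

  Mat : Set
  Mat = Fin card → Fin card → ℚ

  infixl 7 _·_ _×q_
  infixl 6 _⊞_
  _·_ : Mat → Mat → Mat
  (A · B) x y = ∑[ z < card ] (A x z ℚ.* B z y)

  _⊞_ : Mat → Mat → Mat
  (A ⊞ B) x y = A x y ℚ.+ B x y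

  diag : (Fin card → ℚ) → Mat
  diag d x y = ifDec (x Fin.≟ y) (d x)

  Idm Dh Dhinv : Mat
  Idm = diag (λ _ → 1ℚ)
  Dh = diag (λ x → tpow (+ h x))
  Dhinv = diag (λ x → tpow (ℤ.- (+ h x)))

  _×q_ : Mat → Mat → Mat
  A ×q B = (A · Dh) · B

  Zeta Nm : Mat
  Zeta x y = ifDec (x ≼? y) 1ℚ
  Nm x y = Idm x y ℚ.- Zeta x y

  geom : ℕ → Mat
  geom zero x y = 0ℚ
  geom (suc j) = Idm ⊞ (Nm · geom j)

  Zinv : Mat
  Zinv = (Dhinv · geom card) · Dhinv

  Zpow : ℤ → Mat
  Zpow (+ zero) = Dhinv
  Zpow (+ suc k) = Zpow (+ k) ×q Zeta
  Zpow -[1+ zero ] = Zinv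
  Zpow -[1+ suc k ] = Zpow -[1+ k ] ×q Zinv

  Δq : (ℤ → Mat) → (ℤ → Mat)
  Δq a n x y = (a n x y ℚ.- a (n ℤ.- 1ℤ) x y) ℚ.* tpow (ℤ.- n)

  Δiter : ℕ → (ℤ → Mat) → (ℤ → Mat)
  Δiter zero a = a
  Δiter (suc k) a = Δq (Δiter k a)

  chainsAbove : ℕ → Fin card → ℚ
  chainsAbove zero x = 1ℚ
  chainsAbove (suc k) x = ∑[ y < card ] ifDec (x ≼? y) (tpow (+ h y) ℚ.* chainsAbove k y)

  multichainSum : ℕ → ℚ
  multichainSum zero = 1ℚ
  multichainSum (suc k) = ∑[ y < card ] (tpow (+ h y) ℚ.* chainsAbove k y)

  infix 4 _≋_
  record _≋_ (A B : Mat) : Set where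
    constructor entrywise
    field entry : ∀ x y → A x y ≡ B x y
  open _≋_

  ≋-setoid : Setoid _ _
  ≋-setoid = record
    { Carrier = Mat
    ; _≈_ = _≋_
    ; isEquivalence = record
      { refl = entrywise λ _ _ → refl
      ; sym = λ A≋B → entrywise λ x y → sym (entry A≋B x y)
      ; trans = λ A≋B B≋C → entrywise λ x y → trans (entry A≋B x y) (entry B≋C x y)
      }
    }
  open Setoid ≋-setoid public using () renaming (refl to ≋-refl; sym to ≋-sym; trans to ≋-trans)
  module ≋-Reasoning = SetoidReasoning ≋-setoid

  ·-cong : ∀ {A A′ B B′} → A ≋ A′ → B ≋ B′ → A · B ≋ A′ · B′
  ·-cong A≋A′ B≋B′ = entrywise λ x y → sum-cong-≗ (λ z → cong₂ ℚ._*_ (entry A≋A′ x z) (entry B≋B′ z y))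

  ·-congˡ : ∀ A {B B′} → B ≋ B′ → A · B ≋ A · B′
  ·-congˡ A = ·-cong (≋-refl {A})

  ·-congʳ : ∀ C {A A′} → A ≋ A′ → A · C ≋ A′ · C
  ·-congʳ C A≋A′ = ·-cong A≋A′ (≋-refl {C})

  ·-assoc : ∀ A B C → (A · B) · C ≋ A · (B · C)
  ·-assoc A B C = entrywise λ x y → begin
    ∑[ w < card ] (∑[ z < card ] (A x z ℚ.* B z w) ℚ.* C w y)
      ≡⟨ sum-cong-≗ (λ w → *-distribʳ-sum (C w y) (λ z → A x z ℚ.* B z w)) ⟩
    ∑[ w < card ] ∑[ z < card ] (A x z ℚ.* B z w ℚ.* C w y)
      ≡⟨ ∑-comm (λ w z → A x z ℚ.* B z w ℚ.* C w y) ⟩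
    ∑[ z < card ] ∑[ w < card ] (A x z ℚ.* B z w ℚ.* C w y)
      ≡⟨ sum-cong-≗ (λ z → trans (sum-cong-≗ (λ w → ℚP.*-assoc (A x z) (B z w) (C w y))) (sym (*-distribˡ-sum (A x z) (λ w → B z w ℚ.* C w y)))) ⟩
    ∑[ z < card ] (A x z ℚ.* ∑[ w < card ] (B z w ℚ.* C w y)) ∎
    where open ≡-Reasoning

  ·-distribʳ-⊞ : ∀ A B C → (A ⊞ B) · C ≋ A · C ⊞ B · C
  ·-distribʳ-⊞ A B C = entrywise λ x y →
    trans (sum-cong-≗ (λ z → ℚP.*-distribʳ-+ (C z y) (A x z) (B x z))) (∑-distrib-+ (λ z → A x z ℚ.* C z y) (λ z → B x z ℚ.* C z y))

  ·-distribˡ-⊞ : ∀ A B C → A · (B ⊞ C) ≋ A · B ⊞ A · C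
  ·-distribˡ-⊞ A B C = entrywise λ x y →
    trans (sum-cong-≗ (λ z → ℚP.*-distribˡ-+ (A x z) (B z y) (C z y))) (∑-distrib-+ (λ z → A x z ℚ.* B z y) (λ z → A x z ℚ.* C z y))

  diag-·ˡ : ∀ d B → diag d · B ≋ λ x y → d x ℚ.* B x y
  diag-·ˡ d B = entrywise λ x y → trans
    (∑-δ (λ z → diag d x z ℚ.* B z y) x (λ z z≢x → trans (cong (ℚ._* B z y) (ifDec-no (x Fin.≟ z) (z≢x ∘′ sym))) (ℚP.*-zeroˡ (B z y))))
    (cong (ℚ._* B x y) (ifDec-yes (x Fin.≟ x) refl))

  diag-·ʳ : ∀ d A → A · diag d ≋ λ x y → A x y ℚ.* d y
  diag-·ʳ d A = entrywise λ x y → trans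
    (∑-δ (λ z → A x z ℚ.* diag d z y) y (λ z z≢y → trans (cong (A x z ℚ.*_) (ifDec-no (z Fin.≟ y) z≢y)) (ℚP.*-zeroʳ (A x z))))
    (cong (A x y ℚ.*_) (ifDec-yes (y Fin.≟ y) refl))

  ·-identityˡ : ∀ A → Idm · A ≋ A
  ·-identityˡ A = entrywise λ x y → trans (entry (diag-·ˡ (λ _ → 1ℚ) A) x y) (ℚP.*-identityˡ (A x y))

  ·-identityʳ : ∀ A → A · Idm ≋ A
  ·-identityʳ A = entrywise λ x y → trans (entry (diag-·ʳ (λ _ → 1ℚ) A) x y) (ℚP.*-identityʳ (A x y))

  diag-inverse : ∀ d e → (∀ x → d x ℚ.* e x ≡ 1ℚ) → diag d · diag e ≋ Idm
  diag-inverse d e d*e≡1 = entrywise λ x y → trans (entry (diag-·ʳ e (diag d)) x y) (inverse x y (x Fin.≟ y))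
    where
    inverse : ∀ x y (x≟y : Dec (x ≡ y)) → ifDec x≟y (d x) ℚ.* e y ≡ ifDec x≟y 1ℚ
    inverse x .x (yes refl) = d*e≡1 x
    inverse x y (no _) = ℚP.*-zeroˡ (e y)

  tpow-inverse : ∀ k → tpow (ℤ.- (+ k)) ℚ.* tpow (+ k) ≡ 1ℚ
  tpow-inverse zero = refl
  tpow-inverse (suc k) = ^-inverse t⁻¹ t (suc k) t⁻¹*t≡1

  Dhinv·Dh : Dhinv · Dh ≋ Idm
  Dhinv·Dh = diag-inverse _ _ (λ x → tpow-inverse (h x))

  Dh·Dhinv : Dh · Dhinv ≋ Idm
  Dh·Dhinv = diag-inverse _ _ (λ x → trans (ℚP.*-comm (tpow (+ h x)) _) (tpow-inverse (h x)))

  ×q-cong : ∀ {A A′ B B′} → A ≋ A′ → B ≋ B′ → A ×q B ≋ A′ ×q B′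
  ×q-cong A≋A′ B≋B′ = ·-cong (·-congʳ Dh A≋A′) B≋B′

  ×q-assoc : ∀ A B C → (A ×q B) ×q C ≋ A ×q (B ×q C)
  ×q-assoc A B C = ≋-trans (·-congʳ C (·-assoc (A · Dh) B Dh)) (·-assoc (A · Dh) (B · Dh) C)

  ×q-identityˡ : ∀ A → Dhinv ×q A ≋ A
  ×q-identityˡ A = ≋-trans (·-congʳ A Dhinv·Dh) (·-identityˡ A)

  ×q-identityʳ : ∀ A → A ×q Dhinv ≋ A
  ×q-identityʳ A = ≋-trans (·-assoc A Dh Dhinv) (≋-trans (·-congˡ A Dh·Dhinv) (·-identityʳ A))

  ⊞-cong : ∀ {A A′ B B′} → A ≋ A′ → B ≋ B′ → A ⊞ B ≋ A′ ⊞ B′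
  ⊞-cong A≋A′ B≋B′ = entrywise λ x y → cong₂ ℚ._+_ (entry A≋A′ x y) (entry B≋B′ x y)

  ⊞-congˡ : ∀ A {B B′} → B ≋ B′ → A ⊞ B ≋ A ⊞ B′
  ⊞-congˡ A = ⊞-cong (≋-refl {A})

  ⊞-congʳ : ∀ C {A A′} → A ≋ A′ → A ⊞ C ≋ A′ ⊞ C
  ⊞-congʳ C A≋A′ = ⊞-cong A≋A′ (≋-refl {C})

  ⊞-assoc : ∀ A B C → (A ⊞ B) ⊞ C ≋ A ⊞ (B ⊞ C)
  ⊞-assoc A B C = entrywise λ x y → ℚP.+-assoc (A x y) (B x y) (C x y)

  Npow : ℕ → Mat
  Npow zero = Idm
  Npow (suc j) = Nm · Npow j

  Idm≡Zeta : ∀ {x y} → x ≡ y ⊎ ¬ x ≼ y → Idm x y ≡ Zeta x y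
  Idm≡Zeta {x} (inj₁ refl) = trans (ifDec-yes (x Fin.≟ x) refl) (sym (ifDec-yes (x ≼? x) ≼-refl))
  Idm≡Zeta {x} {y} (inj₂ x⋠y) = trans (ifDec-no (x Fin.≟ y) λ { refl → x⋠y ≼-refl }) (sym (ifDec-no (x ≼? y) x⋠y))

  Nm-vanishes : ∀ {x y} → x ≡ y ⊎ ¬ x ≼ y → Nm x y ≡ 0ℚ
  Nm-vanishes {x} {y} off = trans (cong (ℚ._- Zeta x y) (Idm≡Zeta off)) (ℚP.+-inverseʳ (Zeta x y))

  -- N only has entries strictly above the diagonal, and rank increases strictly along them
  Npow-vanishes : ∀ k x y → rank y ℕ.< rank x ℕ.+ k → Npow k x y ≡ 0ℚ
  Npow-vanishes zero x y lt = ifDec-no (x Fin.≟ y) λ { refl → ℕP.<-irrefl refl (subst (rank x ℕ.<_) (ℕP.+-identityʳ (rank x)) lt) }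
  Npow-vanishes (suc k) x y lt = ∑-zero _ λ z → term z (strictlyBelow? x z)
    where
    term : ∀ z → (x ≼ z × x ≢ z) ⊎ (x ≡ z ⊎ ¬ x ≼ z) → Nm x z ℚ.* Npow k z y ≡ 0ℚ
    term z (inj₂ off) = trans (cong (ℚ._* Npow k z y) (Nm-vanishes off)) (ℚP.*-zeroˡ (Npow k z y))
    term z (inj₁ (x≼z , x≢z)) = trans (cong (Nm x z ℚ.*_) (Npow-vanishes k z y lt′)) (ℚP.*-zeroʳ (Nm x z))
      where
      lt′ : rank y ℕ.< rank z ℕ.+ k
      lt′ = ℕP.<-≤-trans lt (ℕP.≤-trans (ℕP.≤-reflexive (ℕP.+-suc (rank x) k)) (ℕP.+-monoˡ-≤ k (rank-strictMono x≼z x≢z)))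

  Npow-card : ∀ x y → Npow card x y ≡ 0ℚ
  Npow-card x y = Npow-vanishes card x y (ℕP.<-≤-trans (ℕ.s≤s (rank≤card y)) (ℕP.+-monoˡ-≤ card (rank-pos x)))

  geom-telescope : ∀ j → geom j · Zeta ⊞ Npow j ≋ Idm
  geom-telescope zero = entrywise λ x y →
    trans (cong (ℚ._+ Idm x y) (∑-zero _ λ z → ℚP.*-zeroˡ (Zeta z y))) (ℚP.+-identityˡ (Idm x y))
  geom-telescope (suc j) = begin
    (Idm ⊞ Nm · G) · Zeta ⊞ Nm · Npow j
      ≈⟨ ⊞-congʳ (Nm · Npow j) (·-distribʳ-⊞ Idm (Nm · G) Zeta) ⟩
    (Idm · Zeta ⊞ (Nm · G) · Zeta) ⊞ Nm · Npow j
      ≈⟨ ⊞-congʳ (Nm · Npow j) (⊞-cong (·-identityˡ Zeta) (·-assoc Nm G Zeta)) ⟩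
    (Zeta ⊞ Nm · (G · Zeta)) ⊞ Nm · Npow j
      ≈⟨ ⊞-assoc Zeta (Nm · (G · Zeta)) (Nm · Npow j) ⟩
    Zeta ⊞ (Nm · (G · Zeta) ⊞ Nm · Npow j)
      ≈˘⟨ ⊞-congˡ Zeta (·-distribˡ-⊞ Nm (G · Zeta) (Npow j)) ⟩
    Zeta ⊞ Nm · (G · Zeta ⊞ Npow j)
      ≈⟨ ⊞-congˡ Zeta (≋-trans (·-congˡ Nm (geom-telescope j)) (·-identityʳ Nm)) ⟩
    Zeta ⊞ Nm
      ≈⟨ entrywise (λ x y → solve 2 (λ i z → z :+ (i :- z) := i) refl (Idm x y) (Zeta x y)) ⟩
    Idm ∎
    where
    open ≋-Reasoning
    G = geom j

  geom-card·Zeta : geom card · Zeta ≋ Idm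
  geom-card·Zeta = ≋-trans (entrywise λ x y → sym (trans (cong (G·Zeta x y ℚ.+_) (Npow-card x y)) (ℚP.+-identityʳ (G·Zeta x y))))
                           (geom-telescope card)
    where G·Zeta = geom card · Zeta

  Zinv×qZeta : Zinv ×q Zeta ≋ Dhinv
  Zinv×qZeta = begin
    (Dhinv · G) · Dhinv · Dh · Zeta   ≈⟨ ·-congʳ Zeta (·-assoc (Dhinv · G) Dhinv Dh) ⟩
    (Dhinv · G) · (Dhinv · Dh) · Zeta ≈⟨ ·-congʳ Zeta (·-congˡ (Dhinv · G) Dhinv·Dh) ⟩
    (Dhinv · G) · Idm · Zeta          ≈⟨ ·-congʳ Zeta (·-identityʳ (Dhinv · G)) ⟩
    Dhinv · G · Zeta                  ≈⟨ ·-assoc Dhinv G Zeta ⟩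
    Dhinv · (G · Zeta)                ≈⟨ ·-congˡ Dhinv geom-card·Zeta ⟩
    Dhinv · Idm                       ≈⟨ ·-identityʳ Dhinv ⟩
    Dhinv                             ∎
    where
    open ≋-Reasoning
    G = geom card

  Zpow-pred : ∀ n → Zpow n ≋ Zpow (n ℤ.- 1ℤ) ×q Zeta
  Zpow-pred (+ zero) = ≋-sym Zinv×qZeta
  Zpow-pred (+ suc k) = ≋-refl
  Zpow-pred -[1+ k ] rewrite ℕP.+-identityʳ k = ≋-sym (begin
    (Zpow -[1+ k ] ×q Zinv) ×q Zeta ≈⟨ ×q-assoc (Zpow -[1+ k ]) Zinv Zeta ⟩
    Zpow -[1+ k ] ×q (Zinv ×q Zeta) ≈⟨ ×q-cong (≋-refl {Zpow -[1+ k ]}) Zinv×qZeta ⟩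
    Zpow -[1+ k ] ×q Dhinv          ≈⟨ ×q-identityʳ (Zpow -[1+ k ]) ⟩
    Zpow -[1+ k ]                   ∎)
    where open ≋-Reasoning

  column : Fin card → Fin card → Seq
  column x y n = Zpow n x y

  strictZeta : Mat
  strictZeta w y = Zeta w y ℚ.- Idm w y

  strictZeta-vanishes : ∀ {w y} → w ≡ y ⊎ ¬ w ≼ y → strictZeta w y ≡ 0ℚ
  strictZeta-vanishes {w} {y} off = trans (cong (λ i → Zeta w y ℚ.- i) (Idm≡Zeta off)) (ℚP.+-inverseʳ (Zeta w y))

  column-recurrence : ∀ x y n →
    diff (h y) (column x y) n ≡ ∑[ w < card ] (t ^ h w ℚ.* strictZeta w y ℚ.* column x w (n ℤ.- 1ℤ))
  column-recurrence x y n = begin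
    Zpow n x y ℚ.- t ^ h y ℚ.* a y
      ≡⟨ cong₂ ℚ._-_ Zpow≡ t^hy*ay≡ ⟩
    ∑[ w < card ] (a w ℚ.* t ^ h w ℚ.* Zeta w y) ℚ.- ∑[ w < card ] (a w ℚ.* t ^ h w ℚ.* Idm w y)
      ≡˘⟨ ∑-distrib-minus (λ w → a w ℚ.* t ^ h w ℚ.* Zeta w y) (λ w → a w ℚ.* t ^ h w ℚ.* Idm w y) ⟩
    ∑[ w < card ] (a w ℚ.* t ^ h w ℚ.* Zeta w y ℚ.- a w ℚ.* t ^ h w ℚ.* Idm w y)
      ≡⟨ sum-cong-≗ (λ w → solve 4 (λ a p z i → a :* p :* z :- a :* p :* i := p :* (z :- i) :* a) refl (a w) (t ^ h w) (Zeta w y) (Idm w y)) ⟩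
    ∑[ w < card ] (t ^ h w ℚ.* strictZeta w y ℚ.* a w) ∎
    where
    open ≡-Reasoning
    a : Fin card → ℚ
    a w = Zpow (n ℤ.- 1ℤ) x w
    Zpow≡ : Zpow n x y ≡ ∑[ w < card ] (a w ℚ.* t ^ h w ℚ.* Zeta w y)
    Zpow≡ = trans (entry (Zpow-pred n) x y) (sum-cong-≗ λ w → cong (ℚ._* Zeta w y) (entry (diag-·ʳ _ (Zpow (n ℤ.- 1ℤ))) x w))
    t^hy*ay≡ : t ^ h y ℚ.* a y ≡ ∑[ w < card ] (a w ℚ.* t ^ h w ℚ.* Idm w y)
    t^hy*ay≡ = trans (ℚP.*-comm (t ^ h y) (a y)) (sym (entry (·-identityʳ λ _ w → a w ℚ.* t ^ h w) x y))

  column-annihilated : IsHeight P h → ∀ x y → Annihilated (suc (h y)) (column x y)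
  column-annihilated isHeight x y = byHeight (suc (h y)) y ℕP.≤-refl
    where
    byHeight : ∀ N y → h y ℕ.< N → Annihilated (suc (h y)) (column x y)
    byHeight (suc N) y hy<N = annihilated-diff (column x y)
      (annihilated-cong (λ n → sym (column-recurrence x y n)) (annihilated-∑ _ λ w → term w (strictlyBelow? w y)))
      where
      term : ∀ w → (w ≼ y × w ≢ y) ⊎ (w ≡ y ⊎ ¬ w ≼ y) →
        Annihilated (h y) (λ n → t ^ h w ℚ.* strictZeta w y ℚ.* column x w (n ℤ.- 1ℤ))
      term w (inj₂ off) = annihilated-cong
        (λ n → sym (trans (cong (λ c → t ^ h w ℚ.* c ℚ.* column x w (n ℤ.- 1ℤ)) (strictZeta-vanishes off))
                          (solve 2 (λ p c → p :* con 0ℚ :* c := con 0ℚ) refl (t ^ h w) (column x w (n ℤ.- 1ℤ)))))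
        (annihilated-0 (h y))
      term w (inj₁ (w≼y , w≢y)) = annihilated-* (t ^ h w ℚ.* strictZeta w y)
        (annihilated-shift (annihilated-≤ hw<hy (byHeight N w (ℕP.<-≤-trans hw<hy (ℕP.≤-pred hy<N)))))
        where
        hw<hy : h w ℕ.< h y
        hw<hy = height-strictMono h isHeight w≼y w≢y

  Δiter-diffs : ∀ k a n x y → Δiter k a n x y ≡ tpow (ℤ.- n) ^ k ℚ.* diffs 0 k (λ m → a m x y) n
  Δiter-diffs zero a n x y = sym (ℚP.*-identityˡ (a n x y))
  Δiter-diffs (suc k) a n x y = begin
    (Δiter k a n x y ℚ.- Δiter k a (n ℤ.- 1ℤ) x y) ℚ.* u
      ≡⟨ cong₂ (λ p q → (p ℚ.- q) ℚ.* u) (Δiter-diffs k a n x y) (Δiter-diffs k a (n ℤ.- 1ℤ) x y) ⟩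
    (u ^ k ℚ.* d n ℚ.- tpow (ℤ.- (n ℤ.- 1ℤ)) ^ k ℚ.* d (n ℤ.- 1ℤ)) ℚ.* u
      ≡⟨ cong (λ w → (u ^ k ℚ.* d n ℚ.- w ^ k ℚ.* d (n ℤ.- 1ℤ)) ℚ.* u) (tpow-neg-pred n) ⟩
    (u ^ k ℚ.* d n ℚ.- (u ℚ.* t) ^ k ℚ.* d (n ℤ.- 1ℤ)) ℚ.* u
      ≡⟨ cong (λ w → (u ^ k ℚ.* d n ℚ.- w ℚ.* d (n ℤ.- 1ℤ)) ℚ.* u) (^-distrib-* u t k) ⟩
    (u ^ k ℚ.* d n ℚ.- u ^ k ℚ.* t ^ k ℚ.* d (n ℤ.- 1ℤ)) ℚ.* u
      ≡⟨ solve 5 (λ u uk tk d₀ d₁ → (uk :* d₀ :- uk :* tk :* d₁) :* u := (u :* uk) :* (d₀ :- tk :* d₁)) refl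
           u (u ^ k) (t ^ k) (d n) (d (n ℤ.- 1ℤ)) ⟩
    u ^ suc k ℚ.* diff k d n ∎
    where
    open ≡-Reasoning
    u = tpow (ℤ.- n)
    d = diffs 0 k (λ m → a m x y)

  Δiter-Zpow≡0 : IsHeight P h → ∀ H → (∀ x → h x ℕ.≤ H) → ∀ n x y → Δiter (suc H) Zpow n x y ≡ 0ℚ
  Δiter-Zpow≡0 isHeight H h≤H n x y = begin
    Δiter (suc H) Zpow n x y                              ≡⟨ Δiter-diffs (suc H) Zpow n x y ⟩
    tpow (ℤ.- n) ^ suc H ℚ.* diffs 0 (suc H) (column x y) n ≡⟨ cong (tpow (ℤ.- n) ^ suc H ℚ.*_) (vanishes ann n) ⟩
    tpow (ℤ.- n) ^ suc H ℚ.* 0ℚ                           ≡⟨ ℚP.*-zeroʳ (tpow (ℤ.- n) ^ suc H) ⟩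
    0ℚ                                                    ∎
    where
    open ≡-Reasoning
    ann = annihilated-≤ (ℕ.s≤s (h≤H y)) (column-annihilated isHeight x y)

  Zpow-one : Zpow (+ 1) ≋ Zeta
  Zpow-one = ×q-identityˡ Zeta

  Zpow-comm : ∀ k → Zpow (+ suc k) ×q Zeta ≋ Zeta ×q Zpow (+ suc k)
  Zpow-comm zero = ≋-trans (×q-cong Zpow-one (≋-refl {Zeta})) (×q-cong (≋-refl {Zeta}) (≋-sym Zpow-one))
  Zpow-comm (suc k) = ≋-trans (×q-cong (Zpow-comm k) (≋-refl {Zeta})) (×q-assoc Zeta (Zpow (+ suc k)) Zeta)

  Zpow-top : ∀ k x → Zpow (+ suc k) x top ≡ chainsAbove k x
  Zpow-top zero x = trans (entry Zpow-one x top) (ifDec-yes (x ≼? top) (top-max x))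
  Zpow-top (suc k) x = begin
    Zpow (+ suc (suc k)) x top
      ≡⟨ entry (Zpow-comm k) x top ⟩
    ∑[ w < card ] ((Zeta · Dh) x w ℚ.* Zpow (+ suc k) w top)
      ≡⟨ sum-cong-≗ (λ w → cong₂ ℚ._*_ (entry (diag-·ʳ _ Zeta) x w) (Zpow-top k w)) ⟩
    ∑[ w < card ] (Zeta x w ℚ.* tpow (+ h w) ℚ.* chainsAbove k w)
      ≡⟨ sum-cong-≗ (λ w → trans (ℚP.*-assoc (Zeta x w) (tpow (+ h w)) (chainsAbove k w)) (ifDec-1* (x ≼? w) _)) ⟩
    chainsAbove (suc k) x ∎
    where open ≡-Reasoning

  multichainSum≡chainsAbove-bot : ∀ k → multichainSum k ≡ chainsAbove k bot
  multichainSum≡chainsAbove-bot zero = refl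
  multichainSum≡chainsAbove-bot (suc k) = sum-cong-≗ (λ y → sym (ifDec-yes (bot ≼? y) (bot-min y)))

  evalPoly-tint≡Zpow : IsHeight P h → ∀ H → (∀ x → h x ℕ.≤ H) →
    ∀ f → (∀ j → evalPoly f (tint (+ (2 ℕ.+ j))) ≡ multichainSum (suc j)) →
    ∀ n → evalPoly f (tint n) ≡ Zpow n bot top
  evalPoly-tint≡Zpow isHeight H h≤H f agreeFrom2 n = p-q≡0⇒p≡q _ _ (annihilated∧eventually0⇒0 2 difference ann agree n)
    where
    difference : Seq
    difference n = evalPoly f (tint n) ℚ.- column bot top n
    ann : Annihilated (length f ℕ.+ suc H) difference
    ann = annihilated-minus (annihilated-≤ (ℕP.m≤m+n (length f) (suc H)) (annihilated-evalPoly f))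
                        (annihilated-≤ (ℕP.≤-trans (ℕ.s≤s (h≤H top)) (ℕP.m≤n+m (suc H) (length f))) (column-annihilated isHeight bot top))
    agree : ∀ j → difference (+ (2 ℕ.+ j)) ≡ 0ℚ
    agree j = trans (cong (ℚ._- column bot top (+ (2 ℕ.+ j)))
                          (trans (agreeFrom2 j) (trans (multichainSum≡chainsAbove-bot (suc j)) (sym (Zpow-top (suc j) bot)))))
                    (ℚP.+-inverseʳ (column bot top (+ (2 ℕ.+ j))))

crossDifference : ℚq → ℚq → Poly
crossDifference a b = (num a ⊛ den b) ⊕ ⊝ (num b ⊛ den a)

-- q specialised to the integer 2 + k, where both q and q - 1 are invertible
module Evaluation (k : ℕ) where
  X : ℤ
  X = + (2 ℕ.+ k)

  Evaluable : ℚq → Set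
  Evaluable c = evalℤ (den c) X ≢ 0ℤ

  ⟦_⟧ : Poly → ℚ
  ⟦ p ⟧ = fromℤ (evalℤ p X)

  ⟦⟧-⊕ : ∀ p r → ⟦ p ⊕ r ⟧ ≡ ⟦ p ⟧ ℚ.+ ⟦ r ⟧
  ⟦⟧-⊕ p r = trans (cong fromℤ (evalℤ-⊕ p r X)) (fromℤ-+ (evalℤ p X) (evalℤ r X))

  ⟦⟧-⊛ : ∀ p r → ⟦ p ⊛ r ⟧ ≡ ⟦ p ⟧ ℚ.* ⟦ r ⟧
  ⟦⟧-⊛ p r = trans (cong fromℤ (evalℤ-⊛ p r X)) (fromℤ-* (evalℤ p X) (evalℤ r X))

  ⟦⟧-⊝ : ∀ p → ⟦ ⊝ p ⟧ ≡ ℚ.- ⟦ p ⟧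
  ⟦⟧-⊝ p = trans (cong fromℤ (evalℤ-⊝ p X)) (fromℤ-neg (evalℤ p X))

  X≢0 : X ≢ 0ℤ
  X≢0 ()

  X-1≢0 : X ℤ.+ -1ℤ ≢ 0ℤ
  X-1≢0 ()

  t : ℚ
  t = fromℤ X

  instance
    t-nonZero : ℚ.NonZero t
    t-nonZero = ℚ.≢-nonZero (fromℤ-≢0 X≢0)

    t-1-nonZero : ℚ.NonZero (t ℚ.- 1ℚ)
    t-1-nonZero = ℚ.≢-nonZero (subst (_≢ 0ℚ) (fromℤ-+ X -1ℤ) (fromℤ-≢0 X-1≢0))

  t⁻¹ s : ℚ
  t⁻¹ = ℚ.1/ t
  s = ℚ.1/ (t ℚ.- 1ℚ)

  t⁻¹*t≡1 : t⁻¹ ℚ.* t ≡ 1ℚ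
  t⁻¹*t≡1 = ℚP.*-inverseˡ t

  ⟦1⟧ : ⟦ 1ℤ ∷ [] ⟧ ≡ 1ℚ
  ⟦1⟧ = cong fromℤ (evalℤ-Xpow 0 X)

  1≢0 : evalℤ (1ℤ ∷ []) X ≢ 0ℤ
  1≢0 eq with trans (sym (evalℤ-Xpow 0 X)) eq
  ... | ()

  infix 4 _↦_
  record _↦_ (a : ℚq) (v : ℚ) : Set where
    constructor evaluates
    field
      den≢0 : Evaluable a
      num≡v*den : ⟦ num a ⟧ ≡ v ℚ.* ⟦ den a ⟧

  ↦-+ : ∀ {a b u v} → a ↦ u → b ↦ v → a +q b ↦ u ℚ.+ v
  ↦-+ {a} {b} {u} {v} (evaluates da≢0 na≡) (evaluates db≢0 nb≡) =
    evaluates (λ eq → *-≢0 da≢0 db≢0 (trans (sym (evalℤ-⊛ (den a) (den b) X)) eq)) (begin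
      ⟦ (num a ⊛ den b) ⊕ (num b ⊛ den a) ⟧
        ≡⟨ trans (⟦⟧-⊕ (num a ⊛ den b) (num b ⊛ den a)) (cong₂ ℚ._+_ (⟦⟧-⊛ (num a) (den b)) (⟦⟧-⊛ (num b) (den a))) ⟩
      ⟦ num a ⟧ ℚ.* ⟦ den b ⟧ ℚ.+ ⟦ num b ⟧ ℚ.* ⟦ den a ⟧
        ≡⟨ cong₂ ℚ._+_ (cong (ℚ._* ⟦ den b ⟧) na≡) (cong (ℚ._* ⟦ den a ⟧) nb≡) ⟩
      u ℚ.* ⟦ den a ⟧ ℚ.* ⟦ den b ⟧ ℚ.+ v ℚ.* ⟦ den b ⟧ ℚ.* ⟦ den a ⟧
        ≡⟨ solve 4 (λ u v x y → u :* x :* y :+ v :* y :* x := (u :+ v) :* (x :* y)) refl u v ⟦ den a ⟧ ⟦ den b ⟧ ⟩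
      (u ℚ.+ v) ℚ.* (⟦ den a ⟧ ℚ.* ⟦ den b ⟧)
        ≡˘⟨ cong ((u ℚ.+ v) ℚ.*_) (⟦⟧-⊛ (den a) (den b)) ⟩
      (u ℚ.+ v) ℚ.* ⟦ den a ⊛ den b ⟧ ∎)
    where open ≡-Reasoning

  ↦-* : ∀ {a b u v} → a ↦ u → b ↦ v → a *q b ↦ u ℚ.* v
  ↦-* {a} {b} {u} {v} (evaluates da≢0 na≡) (evaluates db≢0 nb≡) =
    evaluates (λ eq → *-≢0 da≢0 db≢0 (trans (sym (evalℤ-⊛ (den a) (den b) X)) eq)) (begin
      ⟦ num a ⊛ num b ⟧                                 ≡⟨ ⟦⟧-⊛ (num a) (num b) ⟩
      ⟦ num a ⟧ ℚ.* ⟦ num b ⟧                           ≡⟨ cong₂ ℚ._*_ na≡ nb≡ ⟩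
      u ℚ.* ⟦ den a ⟧ ℚ.* (v ℚ.* ⟦ den b ⟧)
        ≡⟨ solve 4 (λ u v x y → u :* x :* (v :* y) := (u :* v) :* (x :* y)) refl u v ⟦ den a ⟧ ⟦ den b ⟧ ⟩
      (u ℚ.* v) ℚ.* (⟦ den a ⟧ ℚ.* ⟦ den b ⟧)           ≡˘⟨ cong ((u ℚ.* v) ℚ.*_) (⟦⟧-⊛ (den a) (den b)) ⟩
      (u ℚ.* v) ℚ.* ⟦ den a ⊛ den b ⟧                   ∎)
    where open ≡-Reasoning

  ↦-neg : ∀ {a u} → a ↦ u → -q a ↦ ℚ.- u
  ↦-neg {a} {u} (evaluates da≢0 na≡) = evaluates da≢0 (begin
    ⟦ ⊝ num a ⟧                ≡⟨ ⟦⟧-⊝ (num a) ⟩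
    ℚ.- ⟦ num a ⟧              ≡⟨ cong ℚ.-_ na≡ ⟩
    ℚ.- (u ℚ.* ⟦ den a ⟧)      ≡⟨ ℚP.neg-distribˡ-* u ⟦ den a ⟧ ⟩
    ℚ.- u ℚ.* ⟦ den a ⟧        ∎)
    where open ≡-Reasoning

  ↦-0 : 0q ↦ 0ℚ
  ↦-0 = evaluates 1≢0 (sym (ℚP.*-zeroˡ ⟦ 1ℤ ∷ [] ⟧))

  ↦-1 : 1q ↦ 1ℚ
  ↦-1 = evaluates 1≢0 (sym (ℚP.*-identityˡ ⟦ 1ℤ ∷ [] ⟧))

  open QDifferences t t⁻¹ s t⁻¹*t≡1 public using (tpow; tint; evalPoly)

  ↦-qpow : ∀ n → qpow n ↦ tpow n
  ↦-qpow (+ j) = evaluates 1≢0 (begin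
    ⟦ Xpow j ⟧             ≡⟨ cong fromℤ (evalℤ-Xpow j X) ⟩
    fromℤ (X ℤ.^ j)        ≡⟨ fromℤ-^ X j ⟩
    t ^ j                  ≡˘⟨ ℚP.*-identityʳ (t ^ j) ⟩
    t ^ j ℚ.* 1ℚ           ≡˘⟨ cong (t ^ j ℚ.*_) ⟦1⟧ ⟩
    t ^ j ℚ.* ⟦ 1ℤ ∷ [] ⟧  ∎)
    where open ≡-Reasoning
  ↦-qpow -[1+ j ] = evaluates (λ eq → X≢0 (ℤP.i^n≡0⇒i≡0 X (suc j) (trans (sym (evalℤ-Xpow (suc j) X)) eq))) (begin
    ⟦ 1ℤ ∷ [] ⟧                           ≡⟨ ⟦1⟧ ⟩
    1ℚ                                    ≡˘⟨ ^-inverse t⁻¹ t (suc j) t⁻¹*t≡1 ⟩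
    t⁻¹ ^ suc j ℚ.* t ^ suc j             ≡˘⟨ cong (t⁻¹ ^ suc j ℚ.*_) (trans (cong fromℤ (evalℤ-Xpow (suc j) X)) (fromℤ-^ X (suc j))) ⟩
    t⁻¹ ^ suc j ℚ.* ⟦ Xpow (suc j) ⟧      ∎)
    where open ≡-Reasoning

  ↦-qint : ∀ n → qint n ↦ tint n
  ↦-qint n = ↦-* (↦-+ (↦-qpow n) (↦-neg ↦-1)) (evaluates q-1≢0 (begin
    ⟦ 1ℤ ∷ [] ⟧                ≡⟨ ⟦1⟧ ⟩
    1ℚ                         ≡˘⟨ ℚP.*-inverseˡ (t ℚ.- 1ℚ) ⟩
    s ℚ.* (t ℚ.- 1ℚ)           ≡˘⟨ cong (s ℚ.*_) (trans (cong fromℤ q-1≡X-1) (fromℤ-+ X -1ℤ)) ⟩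
    s ℚ.* ⟦ -1ℤ ∷ 1ℤ ∷ [] ⟧    ∎))
    where
    open ≡-Reasoning
    q-1≡X-1 : evalℤ (-1ℤ ∷ 1ℤ ∷ []) X ≡ X ℤ.+ -1ℤ
    q-1≡X-1 = trans (cong (λ z → -1ℤ ℤ.+ X ℤ.* z) (evalℤ-Xpow 0 X))
                    (trans (cong (λ z → -1ℤ ℤ.+ z) (ℤP.*-identityʳ X)) (ℤP.+-comm -1ℤ X))
    q-1≢0 : evalℤ (-1ℤ ∷ 1ℤ ∷ []) X ≢ 0ℤ
    q-1≢0 eq = X-1≢0 (trans (sym q-1≡X-1) eq)

  ↦-ifDec : ∀ {A : Set} (d : Dec A) {a u} → a ↦ u → D.ifDec d a ↦ ifDec d u
  ↦-ifDec (yes _) a↦u = a↦u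
  ↦-ifDec (no _) _ = ↦-0

  ↦-sumF : ∀ {K} {f : Fin K → ℚq} {g : Fin K → ℚ} → (∀ i → f i ↦ g i) → sumF f ↦ sum g
  ↦-sumF {zero} _ = ↦-0
  ↦-sumF {suc K} f↦g = ↦-+ (f↦g Fin.zero) (↦-sumF (λ i → f↦g (Fin.suc i)))

  value : (c : ℚq) → Evaluable c → ℚ
  value c den≢0 = ⟦ num c ⟧ ℚ.* ℚ.1/ ⟦ den c ⟧
    where instance _ = ℚ.≢-nonZero (fromℤ-≢0 den≢0)

  ↦-value : ∀ c den≢0 → c ↦ value c den≢0
  ↦-value c den≢0 = evaluates den≢0 (begin
    ⟦ num c ⟧                                     ≡˘⟨ ℚP.*-identityʳ ⟦ num c ⟧ ⟩
    ⟦ num c ⟧ ℚ.* 1ℚ                              ≡˘⟨ cong (⟦ num c ⟧ ℚ.*_) (ℚP.*-inverseˡ ⟦ den c ⟧) ⟩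
    ⟦ num c ⟧ ℚ.* (ℚ.1/ ⟦ den c ⟧ ℚ.* ⟦ den c ⟧)  ≡˘⟨ ℚP.*-assoc ⟦ num c ⟧ (ℚ.1/ ⟦ den c ⟧) ⟦ den c ⟧ ⟩
    value c den≢0 ℚ.* ⟦ den c ⟧                   ∎)
    where
    open ≡-Reasoning
    instance _ = ℚ.≢-nonZero (fromℤ-≢0 den≢0)

  coefficients : ∀ {f} → All Evaluable f → List ℚ
  coefficients [] = []
  coefficients {c ∷ _} (den≢0 ∷ evaluable) = value c den≢0 ∷ coefficients evaluable

  ↦-evalX : ∀ {f x v} (evaluable : All Evaluable f) → x ↦ v → evalX f x ↦ evalPoly (coefficients evaluable) v
  ↦-evalX [] _ = ↦-0
  ↦-evalX {c ∷ _} (den≢0 ∷ evaluable) x↦v = ↦-+ (↦-value c den≢0) (↦-* x↦v (↦-evalX evaluable x↦v))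

  ⟦crossDifference⟧ : ∀ {a b u v} → a ↦ u → b ↦ v → ⟦ crossDifference a b ⟧ ≡ (u ℚ.- v) ℚ.* (⟦ den a ⟧ ℚ.* ⟦ den b ⟧)
  ⟦crossDifference⟧ {a} {b} {u} {v} (evaluates _ na≡) (evaluates _ nb≡) = begin
    ⟦ (num a ⊛ den b) ⊕ ⊝ (num b ⊛ den a) ⟧
      ≡⟨ trans (⟦⟧-⊕ (num a ⊛ den b) (⊝ (num b ⊛ den a)))
               (cong₂ ℚ._+_ (⟦⟧-⊛ (num a) (den b)) (trans (⟦⟧-⊝ (num b ⊛ den a)) (cong ℚ.-_ (⟦⟧-⊛ (num b) (den a))))) ⟩
    ⟦ num a ⟧ ℚ.* ⟦ den b ⟧ ℚ.- ⟦ num b ⟧ ℚ.* ⟦ den a ⟧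
      ≡⟨ cong₂ (λ p q → p ℚ.* ⟦ den b ⟧ ℚ.- q ℚ.* ⟦ den a ⟧) na≡ nb≡ ⟩
    u ℚ.* ⟦ den a ⟧ ℚ.* ⟦ den b ⟧ ℚ.- v ℚ.* ⟦ den b ⟧ ℚ.* ⟦ den a ⟧
      ≡⟨ solve 4 (λ u v x y → u :* x :* y :- v :* y :* x := (u :- v) :* (x :* y)) refl u v ⟦ den a ⟧ ⟦ den b ⟧ ⟩
    (u ℚ.- v) ℚ.* (⟦ den a ⟧ ℚ.* ⟦ den b ⟧) ∎
    where open ≡-Reasoning

  ↦-≈ : ∀ {a b u v} → a ≈ b → a ↦ u → b ↦ v → u ≡ v
  ↦-≈ {a} {b} {u} {v} a≈b a↦u b↦v = p-q≡0⇒p≡q u v (*-cancelʳ-0 (u ℚ.- v) (⟦ den a ⟧ ℚ.* ⟦ den b ⟧) dens≢0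
    (trans (sym (⟦crossDifference⟧ a↦u b↦v)) (cong fromℤ (evalℤ-IsZeroP X a≈b))))
    where
    dens≢0 : ⟦ den a ⟧ ℚ.* ⟦ den b ⟧ ≢ 0ℚ
    dens≢0 eq = fromℤ-≢0 (*-≢0 (_↦_.den≢0 a↦u) (_↦_.den≢0 b↦v)) (trans (fromℤ-* (evalℤ (den a) X) (evalℤ (den b) X)) eq)

  ↦-sameValue : ∀ {a b v} → a ↦ v → b ↦ v → evalℤ (crossDifference a b) X ≡ 0ℤ
  ↦-sameValue {a} {b} {v} a↦v b↦v = fromℤ-injective (begin
    ⟦ crossDifference a b ⟧                    ≡⟨ ⟦crossDifference⟧ a↦v b↦v ⟩
    (v ℚ.- v) ℚ.* (⟦ den a ⟧ ℚ.* ⟦ den b ⟧)    ≡⟨ cong (ℚ._* (⟦ den a ⟧ ℚ.* ⟦ den b ⟧)) (ℚP.+-inverseʳ v) ⟩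
    0ℚ ℚ.* (⟦ den a ⟧ ℚ.* ⟦ den b ⟧)           ≡⟨ ℚP.*-zeroˡ (⟦ den a ⟧ ℚ.* ⟦ den b ⟧) ⟩
    0ℚ                                         ∎)
    where open ≡-Reasoning

  module MatrixEvaluation (P : FinBoundedPoset) (h : Fin (size P) → ℕ) where
    open FinBoundedPoset P using (card; _≼?_)
    module Q = Matrices t t⁻¹ s t⁻¹*t≡1 P h

    infix 4 _↦ᴹ_
    _↦ᴹ_ : D.Mat P h → Q.Mat → Set
    A ↦ᴹ A′ = ∀ x y → A x y ↦ A′ x y

    ↦ᴹ-· : ∀ {A A′ B B′} → A ↦ᴹ A′ → B ↦ᴹ B′ → D._·_ P h A B ↦ᴹ A′ Q.· B′
    ↦ᴹ-· A↦A′ B↦B′ x y = ↦-sumF (λ z → ↦-* (A↦A′ x z) (B↦B′ z y))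

    ↦ᴹ-⊞ : ∀ {A A′ B B′} → A ↦ᴹ A′ → B ↦ᴹ B′ → D._⊞_ P h A B ↦ᴹ A′ Q.⊞ B′
    ↦ᴹ-⊞ A↦A′ B↦B′ x y = ↦-+ (A↦A′ x y) (B↦B′ x y)

    ↦ᴹ-Idm : D.Idm P h ↦ᴹ Q.Idm
    ↦ᴹ-Idm x y = ↦-ifDec (x Fin.≟ y) ↦-1

    ↦ᴹ-Dh : D.Dh P h ↦ᴹ Q.Dh
    ↦ᴹ-Dh x y = ↦-ifDec (x Fin.≟ y) (↦-qpow (+ h x))

    ↦ᴹ-Dhinv : D.Dhinv P h ↦ᴹ Q.Dhinv
    ↦ᴹ-Dhinv x y = ↦-ifDec (x Fin.≟ y) (↦-qpow (ℤ.- (+ h x)))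

    ↦ᴹ-×q : ∀ {A A′ B B′} → A ↦ᴹ A′ → B ↦ᴹ B′ → D._×q_ P h A B ↦ᴹ A′ Q.×q B′
    ↦ᴹ-×q A↦A′ B↦B′ = ↦ᴹ-· (↦ᴹ-· A↦A′ ↦ᴹ-Dh) B↦B′

    ↦ᴹ-Zeta : D.Zeta P h ↦ᴹ Q.Zeta
    ↦ᴹ-Zeta x y = ↦-ifDec (x ≼? y) ↦-1

    ↦ᴹ-geom : ∀ j → D.geom P h j ↦ᴹ Q.geom j
    ↦ᴹ-geom zero x y = ↦-0
    ↦ᴹ-geom (suc j) = ↦ᴹ-⊞ ↦ᴹ-Idm (↦ᴹ-· (λ x y → ↦-+ (↦ᴹ-Idm x y) (↦-neg (↦ᴹ-Zeta x y))) (↦ᴹ-geom j))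

    ↦ᴹ-Zpow : ∀ n → D.Zpow P h n ↦ᴹ Q.Zpow n
    ↦ᴹ-Zpow (+ zero) = ↦ᴹ-Dhinv
    ↦ᴹ-Zpow (+ suc j) = ↦ᴹ-×q (↦ᴹ-Zpow (+ j)) ↦ᴹ-Zeta
    ↦ᴹ-Zpow -[1+ zero ] = ↦ᴹ-· (↦ᴹ-· ↦ᴹ-Dhinv (↦ᴹ-geom card)) ↦ᴹ-Dhinv
    ↦ᴹ-Zpow -[1+ suc j ] = ↦ᴹ-×q (↦ᴹ-Zpow -[1+ j ]) (↦ᴹ-Zpow -[1+ zero ])

    ↦ᴹ-Δiter : ∀ j {a a′} → (∀ n → a n ↦ᴹ a′ n) → ∀ n → D.Δiter P h j a n ↦ᴹ Q.Δiter j a′ n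
    ↦ᴹ-Δiter zero a↦a′ = a↦a′
    ↦ᴹ-Δiter (suc j) a↦a′ n x y =
      ↦-* (↦-+ (↦ᴹ-Δiter j a↦a′ n x y) (↦-neg (↦ᴹ-Δiter j a↦a′ (n ℤ.- 1ℤ) x y))) (↦-qpow (ℤ.- n))

    ↦-chainsAbove : ∀ j x → D.chainsAbove P h j x ↦ Q.chainsAbove j x
    ↦-chainsAbove zero x = ↦-1
    ↦-chainsAbove (suc j) x = ↦-sumF (λ y → ↦-ifDec (x ≼? y) (↦-* (↦-qpow (+ h y)) (↦-chainsAbove j y)))

    ↦-multichainSum : ∀ j → D.multichainSum P h j ↦ Q.multichainSum j
    ↦-multichainSum zero = ↦-1
    ↦-multichainSum (suc j) = ↦-sumF (λ y → ↦-* (↦-qpow (+ h y)) (↦-chainsAbove j y))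

open D using (bot; top; IsQZeta; Zpow; Δiter)

≈-byEvaluation : ∀ a b K → (∀ k → K ℕ.≤ k → Σ ℚ λ v → Evaluation._↦_ k a v × Evaluation._↦_ k b v) → a ≈ b
≈-byEvaluation a b K agree = eventuallyRoot⇒IsZeroP (crossDifference a b) (2 ℕ.+ K) root
  where
  root : ∀ m → 2 ℕ.+ K ℕ.≤ m → evalℤ (crossDifference a b) (+ m) ≡ 0ℤ
  root (suc (suc k)) (ℕ.s≤s (ℕ.s≤s K≤k)) with agree k K≤k
  ... | v , a↦v , b↦v = Evaluation.↦-sameValue k a↦v b↦v

eventuallyEvaluable : ∀ f → All Proper f → Σ ℕ λ K → ∀ k → K ℕ.≤ k → All (Evaluation.Evaluable k) f
eventuallyEvaluable [] [] = 0 , λ _ _ → []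
eventuallyEvaluable (c ∷ f) (proper ∷ propers) with ¬IsZeroP⇒eventuallyNonroot (den c) proper | eventuallyEvaluable f propers
... | K₁ , nonroot | K₂ , evaluable = K₁ ℕ.⊔ K₂ , λ k K≤k →
  nonroot (2 ℕ.+ k) (ℕP.≤-trans (ℕP.m≤m⊔n K₁ K₂) (ℕP.≤-trans K≤k (ℕP.m≤n+m k 2)))
  ∷ evaluable k (ℕP.≤-trans (ℕP.m≤n⊔m K₁ K₂) K≤k)

Δiter-Zpow≈0 : ∀ P h → IsHeight P h → ∀ H → (∀ x → h x ≤ H) → ∀ n x y → Δiter P h (suc H) (Zpow P h) n x y ≈ 0q
Δiter-Zpow≈0 P h isHeight H h≤H n x y = ≈-byEvaluation _ _ 0 λ k _ →
  let open Evaluation k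
      open MatrixEvaluation P h
  in 0ℚ , subst (Δiter P h (suc H) (Zpow P h) n x y ↦_) (Q.Δiter-Zpow≡0 isHeight H h≤H n x y) (↦ᴹ-Δiter (suc H) ↦ᴹ-Zpow n x y) , ↦-0

qZeta≈Zpow : ∀ P h → IsHeight P h → ∀ H → (∀ x → h x ≤ H) →
  ∀ f → IsQZeta P h f → ∀ n → evalX f (qint n) ≈ Zpow P h n (bot P) (top P)
qZeta≈Zpow P h isHeight H h≤H f (propers , agreeFrom2) n with eventuallyEvaluable f propers
... | K , evaluable = ≈-byEvaluation _ _ K λ k K≤k →
  let open Evaluation k
      open MatrixEvaluation P h
      fᵥ = coefficients (evaluable k K≤k)
      agreeᵥ : ∀ j → evalPoly fᵥ (tint (+ (2 ℕ.+ j))) ≡ Q.multichainSum (suc j)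
      agreeᵥ j = ↦-≈ (agreeFrom2 (2 ℕ.+ j) (ℕ.s≤s (ℕ.s≤s ℕ.z≤n))) (↦-evalX (evaluable k K≤k) (↦-qint (+ (2 ℕ.+ j)))) (↦-multichainSum (suc j))
  in Q.Zpow n (bot P) (top P) ,
     subst (evalX f (qint n) ↦_) (Q.evalPoly-tint≡Zpow isHeight H h≤H fᵥ agreeᵥ n) (↦-evalX (evaluable k K≤k) (↦-qint n)) ,
     ↦ᴹ-Zpow n (bot P) (top P)

mainTheorem18 : (P : FinBoundedPoset) (h : Fin (size P) → ℕ) → IsHeight P h →
    (H : ℕ) → (∀ x → h x ≤ H) → (∃ λ x → h x ≡ H) →
    (∀ (n : ℤ) x y → Δiter P h (suc H) (Zpow P h) n x y ≈ 0q)
    × (∀ (f : PolyX) → IsQZeta P h f → ∀ (n : ℤ) → evalX f (qint n) ≈ Zpow P h n (bot P) (top P))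
mainTheorem18 P h isHeight H h≤H _ = Δiter-Zpow≈0 P h isHeight H h≤H , qZeta≈Zpow P h isHeight H h≤H
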